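{- Let $\mathbb{F}$ be a finite field of order at least $2n$, and let $t=10\log n$. Generate a random matrix $M\in\mathbb{F}^{n\times n}$ as follows: independently for each row, sample $t$ positions in that row uniformly at random with repetition, give each sampled position a value chosen uniformly at random from $\mathbb{F}$ (independently), set each entry of the row to the sum of the values assigned to that position (so unsampled entries are $0$). Then $M$ has linearly independent rows (i.e., is nonsingular) with constant probability.
   Context: Logarithms are base 2. -}

module Defs where

open import Level using (Level; _⊔_) renaming (suc to lsuc)
open import Data.Nat using (ℕ; zero; suc; _^_)
open import Data.Nat.Logarithm using (⌈log₂_⌉)
open import Data.Fin using (Fin; zero; suc; _≟_)
open import Data.Product using (_×_; _,_; ∃; ∃-syntax)
open import Data.Vec using (Vec; []; _∷_; lookup)
open import Data.List using (List; length)
open import Data.List.Relation.Unary.All using (All)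
open import Data.List.Relation.Unary.Unique.Propositional using (Unique)
open import Relation.Nullary using (¬_; yes; no)
open import Relation.Binary.PropositionalEquality using (_≡_)
open import Algebra.Bundles using (CommutativeRing)

record FiniteField (c ℓ : Level) : Set (lsuc (c ⊔ ℓ)) where
  field
    commRing : CommutativeRing c ℓ
  open CommutativeRing commRing public
  field
    0≉1             : ¬ (0# ≈ 1#)
    inverse         : ∀ x → ¬ (x ≈ 0#) → ∃[ y ] (x * y ≈ 1#)
    order           : ℕ
    enum            : Fin order → Carrier
    enum-injective  : ∀ i j → enum i ≈ enum j → i ≡ j
    enum-surjective : ∀ x → ∃[ i ] (enum i ≈ x)

module _ {c ℓ : Level} (F : FiniteField c ℓ) where
  open FiniteField F using (Carrier; _≈_; _+_; _*_; 0#; order; enum)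

  sumFin : ∀ {n} → (Fin n → Carrier) → Carrier
  sumFin {zero}  f = 0#
  sumFin {suc n} f = f zero + sumFin (λ i → f (suc i))

  -- One row's random choices: t samples, each a (position, value-index) pair,
  -- the value being enum of the index (uniform over F).
  RowSample : ℕ → ℕ → Set
  RowSample n t = Vec (Fin n × Fin order) t

  rowOf : ∀ {n t} → RowSample n t → Fin n → Carrier
  rowOf []              j = 0#
  rowOf ((p , v) ∷ xs)  j with p ≟ j
  ... | yes _ = enum v + rowOf xs j
  ... | no  _ = rowOf xs j

  Outcome : ℕ → ℕ → Set
  Outcome n t = Vec (RowSample n t) n

  matrix : ∀ {n t} → Outcome n t → Fin n → Fin n → Carrier
  matrix ω i j = rowOf (lookup ω i) j

  RowsIndependent : ∀ {n} → (Fin n → Fin n → Carrier) → Set (c ⊔ ℓ)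
  RowsIndependent {n} M =
    (a : Fin n → Carrier) →
    (∀ j → sumFin (λ i → a i * M i j) ≈ 0#) →
    ∀ i → a i ≈ 0#

  GoodOutcome : ∀ {n t} → Outcome n t → Set (c ⊔ ℓ)
  GoodOutcome ω = RowsIndependent (matrix ω)

-- number of samples per row: t = ⌈10 log₂ n⌉ = ⌈log₂ (n^10)⌉
samples : ℕ → ℕ
samples n = ⌈log₂ (n ^ 10)⌉

{-# OPTIONS --safe #-}

-- Condition on the sampled positions. By Hall's theorem, either some set A of rows
-- hits fewer than |A| columns, or there is an injective σ such that every row i hits
-- column σ i. The first event forces all t|A| samples of the rows of A into some set of
-- |A| - 1 columns; since 2^t ≥ n^10, a union bound over such pairs of sets gives
-- probability at most 1/4.
--
-- Otherwise consider the leading minors formed by the rows 0, …, k-1 and the columns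
-- σ 0, …, σ (k-1). If M is singular, there is a k at which the minor of size k has
-- independent rows but the one of size k+1 does not. Fix every random value except that
-- of a sample of row k landing in column σ k; it shifts the entry (k, σ k) by a uniform
-- element of F, and at most one shift makes this k the first failure: two relations among
-- the rows of the size-(k+1) minors, combined to cancel row k, would give a relation of
-- the size-k minor. So each k has probability at most 1/|F| ≤ 1/(2n), and M is singular
-- with probability at most 1/4 + 1/2.
module Submission where

module Arithmetic where

  open import Data.Nat
  open import Data.Nat.Properties
  open import Data.Nat.Combinatorics using (_C_; nCk+nC[k+1]≡[n+1]C[k+1]; nCk≡nC[n∸k]; k>n⇒nCk≡0)
  open import Data.Nat.Logarithm using (⌈log₂_⌉)
  open import Data.Nat.Logarithm.Core using (⌈log2⌉)
  open import Data.Nat.Induction using (<-wellFounded)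
  open import Data.Nat.Tactic.RingSolver using (solve-∀)
  open import Data.Product using (_,_)
  open import Induction.WellFounded using (Acc; acc)
  open import Relation.Binary.PropositionalEquality
  open import Relation.Nullary using (yes; no)

  ^-distribʳ-* : ∀ m n o → (m * n) ^ o ≡ m ^ o * n ^ o
  ^-distribʳ-* m n zero    = refl
  ^-distribʳ-* m n (suc o) = begin
    m * n * (m * n) ^ o     ≡⟨ cong (m * n *_) (^-distribʳ-* m n o) ⟩
    m * n * (m ^ o * n ^ o) ≡⟨ shuffle m n (m ^ o) (n ^ o) ⟩
    m * m ^ o * (n * n ^ o) ∎
    where
    open ≡-Reasoning
    shuffle : ∀ a b x y → a * b * (x * y) ≡ a * x * (b * y)
    shuffle = solve-∀

  m*m≤n*n⇒m≤n : ∀ {m n} → m * m ≤ n * n → m ≤ n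
  m*m≤n*n⇒m≤n m²≤n² = ≮⇒≥ (λ n<m → <⇒≱ (*-mono-< n<m n<m) m²≤n²)

  n≤2^⌈log₂n⌉ : ∀ n → n ≤ 2 ^ ⌈log₂ n ⌉
  n≤2^⌈log₂n⌉ n = n≤2^⌈log2⌉n n (<-wellFounded n)
    where
    n≤2^⌈log2⌉n : ∀ n (rec : Acc _<_ n) → n ≤ 2 ^ ⌈log2⌉ n rec
    n≤2^⌈log2⌉n zero          _        = z≤n
    n≤2^⌈log2⌉n (suc zero)    _        = s≤s z≤n
    n≤2^⌈log2⌉n (suc (suc n)) (acc rs) = begin
      2 + n                          ≡⟨ cong (2 +_) (⌊n/2⌋+⌈n/2⌉≡n n) ⟨
      2 + (⌊ n /2⌋ + ⌈ n /2⌉)        ≤⟨ +-monoʳ-≤ 2 (+-monoˡ-≤ ⌈ n /2⌉ (⌊n/2⌋≤⌈n/2⌉ n)) ⟩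
      2 + (⌈ n /2⌉ + ⌈ n /2⌉)        ≡⟨ double ⌈ n /2⌉ ⟩
      2 * suc ⌈ n /2⌉                ≤⟨ *-monoʳ-≤ 2 (n≤2^⌈log2⌉n (suc ⌈ n /2⌉) _) ⟩
      2 * 2 ^ ⌈log2⌉ (suc ⌈ n /2⌉) _ ∎
      where
      open ≤-Reasoning
      double : ∀ x → 2 + (x + x) ≡ 2 * suc x
      double = solve-∀

  -- Bernoulli's inequality (1 + 1/m)^k ≥ 1 + k/m, cleared of denominators.
  m^k*[m+k]≤[1+m]^k*m : ∀ m k → m ^ k * (m + k) ≤ suc m ^ k * m
  m^k*[m+k]≤[1+m]^k*m m zero    = *-monoʳ-≤ 1 (≤-reflexive (+-identityʳ m))
  m^k*[m+k]≤[1+m]^k*m m (suc k) = begin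
    m * m ^ k * (m + suc k)                 ≡⟨ expand m (m ^ k) k ⟩
    m * (m ^ k * (m + k)) + m ^ k * m       ≤⟨ +-monoʳ-≤ (m * (m ^ k * (m + k))) (*-monoʳ-≤ (m ^ k) (m≤m+n m k)) ⟩
    m * (m ^ k * (m + k)) + m ^ k * (m + k) ≡⟨ collect m (m ^ k * (m + k)) ⟩
    suc m * (m ^ k * (m + k))               ≤⟨ *-monoʳ-≤ (suc m) (m^k*[m+k]≤[1+m]^k*m m k) ⟩
    suc m * (suc m ^ k * m)                 ≡⟨ *-assoc (suc m) (suc m ^ k) m ⟨
    suc m * suc m ^ k * m                   ∎
    where
    open ≤-Reasoning
    expand : ∀ m x k → m * x * (m + suc k) ≡ m * (x * (m + k)) + x * m
    expand = solve-∀
    collect : ∀ m y → m * y + y ≡ suc m * y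
    collect = solve-∀

  2*m^[1+m]≤[1+m]^[1+m] : ∀ m → 2 * m ^ suc m ≤ suc m ^ suc m
  2*m^[1+m]≤[1+m]^[1+m] zero    = z≤n
  2*m^[1+m]≤[1+m]^[1+m] (suc m) = *-cancelʳ-≤ _ _ (suc m) (begin
    2 * (suc m * x) * suc m           ≡⟨ regroup m x ⟩
    suc m * x * (suc m + suc m)       ≤⟨ *-monoʳ-≤ (suc m * x) (+-monoʳ-≤ (suc m) (n≤1+n (suc m))) ⟩
    suc m * x * (suc m + suc (suc m)) ≤⟨ m^k*[m+k]≤[1+m]^k*m (suc m) (suc (suc m)) ⟩
    suc (suc m) ^ suc (suc m) * suc m ∎)
    where
    open ≤-Reasoning
    x : ℕ
    x = suc m ^ suc m
    regroup : ∀ m x → 2 * (suc m * x) * suc m ≡ suc m * x * (suc m + suc m)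
    regroup = solve-∀

  b^[b+d]*2^d≤[b+d]^[b+d] : ∀ b d → b ^ (b + d) * 2 ^ d ≤ (b + d) ^ (b + d)
  b^[b+d]*2^d≤[b+d]^[b+d] b zero    rewrite +-identityʳ b = ≤-reflexive (*-identityʳ (b ^ b))
  b^[b+d]*2^d≤[b+d]^[b+d] b (suc d) rewrite +-suc b d = begin
    b ^ suc (b + d) * (2 * 2 ^ d)   ≡⟨ regroup (b ^ suc (b + d)) (2 ^ d) ⟩
    2 * b ^ suc (b + d) * 2 ^ d     ≡⟨ cong (λ e → 2 * e * 2 ^ d) (^-distribˡ-+-* b (suc b) d) ⟩
    2 * (b ^ suc b * b ^ d) * 2 ^ d ≤⟨ *-monoˡ-≤ (2 ^ d) step ⟩
    suc b ^ (suc b + d) * 2 ^ d     ≤⟨ b^[b+d]*2^d≤[b+d]^[b+d] (suc b) d ⟩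
    (suc b + d) ^ (suc b + d)       ∎
    where
    open ≤-Reasoning
    regroup : ∀ x y → x * (2 * y) ≡ 2 * x * y
    regroup = solve-∀
    step : 2 * (b ^ suc b * b ^ d) ≤ suc b ^ (suc b + d)
    step = begin
      2 * (b ^ suc b * b ^ d)   ≡⟨ *-assoc 2 (b ^ suc b) (b ^ d) ⟨
      2 * b ^ suc b * b ^ d     ≤⟨ *-mono-≤ (2*m^[1+m]≤[1+m]^[1+m] b) (^-monoˡ-≤ d (n≤1+n b)) ⟩
      suc b ^ suc b * suc b ^ d ≡⟨ ^-distribˡ-+-* (suc b) (suc b) d ⟨
      suc b ^ (suc b + d)       ∎

  nCk≤n^k : ∀ n k → n C k ≤ n ^ k
  nCk≤n^k n       zero    = ≤-refl
  nCk≤n^k zero    (suc k) = z≤n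
  nCk≤n^k (suc n) (suc k) = begin
    suc n C suc k     ≡⟨ nCk+nC[k+1]≡[n+1]C[k+1] n k ⟨
    n C k + n C suc k ≤⟨ +-mono-≤ (nCk≤n^k n k) (nCk≤n^k n (suc k)) ⟩
    n ^ k + n * n ^ k ≤⟨ *-monoʳ-≤ (suc n) (^-monoˡ-≤ k (n≤1+n n)) ⟩
    suc n * suc n ^ k ∎
    where open ≤-Reasoning

  nCk≤n^[n∸k] : ∀ n k → n C k ≤ n ^ (n ∸ k)
  nCk≤n^[n∸k] n k with k ≤? n
  ... | yes k≤n = ≤-trans (≤-reflexive (nCk≡nC[n∸k] k≤n)) (nCk≤n^k n (n ∸ k))
  ... | no  k≰n = ≤-trans (≤-reflexive (k>n⇒nCk≡0 (≰⇒> k≰n))) z≤n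

  [m^n]^o≡[m^o]^n : ∀ m n o → (m ^ n) ^ o ≡ (m ^ o) ^ n
  [m^n]^o≡[m^o]^n m n o = begin
    (m ^ n) ^ o ≡⟨ ^-*-assoc m n o ⟩
    m ^ (n * o) ≡⟨ cong (m ^_) (*-comm n o) ⟩
    m ^ (o * n) ≡⟨ ^-*-assoc m o n ⟨
    (m ^ o) ^ n ∎
    where open ≡-Reasoning

  -- Pairs (A, B) of subsets of an n-set with |A| = b + 1 and |B| = b, each weighted by the
  -- probability (b/n)^(t(b+1)) that all samples of the rows of A land in B, weigh at most n^-3.
  module _ (b c t : ℕ) where

    private
      a n X : ℕ
      a = suc b
      n = a + c
      X = (b ^ t) ^ a

    -- For 2b ≤ n: the binomials are at most n^(2b+1), and 2^t ≥ n^10 is absorbed by (2b)^t ≤ n^t.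
    pairs-bound-sparse : n ^ 10 ≤ 2 ^ t → 2 * b ≤ n → n ^ 3 * ((n C a) * (n C b)) * X ≤ (n ^ t) ^ a
    pairs-bound-sparse n^10≤2^t 2b≤n = begin
      n ^ 3 * ((n C a) * (n C b)) * X ≤⟨ *-monoˡ-≤ X (*-monoʳ-≤ (n ^ 3) (*-mono-≤ (nCk≤n^k n a) (nCk≤n^k n b))) ⟩
      n ^ 3 * (n ^ a * n ^ b) * X     ≡⟨ cong (_* X) (trans (^-distribˡ-+-* n 3 (a + b)) (cong (n ^ 3 *_) (^-distribˡ-+-* n a b))) ⟨
      n ^ (3 + (a + b)) * X           ≤⟨ *-monoˡ-≤ X (^-monoʳ-≤ n exponent) ⟩
      n ^ (10 * a) * X                ≡⟨ cong (_* X) (^-*-assoc n 10 a) ⟨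
      (n ^ 10) ^ a * X                ≤⟨ *-monoˡ-≤ X (^-monoˡ-≤ a n^10≤2^t) ⟩
      (2 ^ t) ^ a * (b ^ t) ^ a       ≡⟨ ^-distribʳ-* (2 ^ t) (b ^ t) a ⟨
      (2 ^ t * b ^ t) ^ a             ≡⟨ cong (_^ a) (^-distribʳ-* 2 b t) ⟨
      ((2 * b) ^ t) ^ a               ≤⟨ ^-monoˡ-≤ a (^-monoˡ-≤ t 2b≤n) ⟩
      (n ^ t) ^ a                     ∎
      where
      open ≤-Reasoning
      count : ∀ b → 3 + (suc b + b) + (6 + 8 * b) ≡ 10 * suc b
      count = solve-∀
      exponent : 3 + (a + b) ≤ 10 * a
      exponent = ≤-trans (m≤m+n (3 + (a + b)) (6 + 8 * b)) (≤-reflexive (count b))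

    -- Since a ≥ n/2, (b/n)^(2a) ≤ (b/n)^n ≤ 2^-(c+1).
    2^[1+c]*b^[2a]≤n^[2a] : n ≤ a + a → 2 ^ suc c * b ^ (a + a) ≤ n ^ (a + a)
    2^[1+c]*b^[2a]≤n^[2a] n≤2a with m≤n⇒∃[o]m+o≡n n≤2a
    ... | d , n+d≡2a = begin
      2 ^ suc c * b ^ (a + a)     ≡⟨ cong (λ k → 2 ^ suc c * b ^ k) n+d≡2a ⟨
      2 ^ suc c * b ^ (n + d)     ≡⟨ cong (2 ^ suc c *_) (^-distribˡ-+-* b n d) ⟩
      2 ^ suc c * (b ^ n * b ^ d) ≡⟨ regroup (2 ^ suc c) (b ^ n) (b ^ d) ⟩
      b ^ n * 2 ^ suc c * b ^ d   ≤⟨ *-mono-≤ b^n*2^[1+c]≤n^n (^-monoˡ-≤ d (≤-trans (n≤1+n b) (m≤m+n a c))) ⟩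
      n ^ n * n ^ d               ≡⟨ ^-distribˡ-+-* n n d ⟨
      n ^ (n + d)                 ≡⟨ cong (n ^_) n+d≡2a ⟩
      n ^ (a + a)                 ∎
      where
      open ≤-Reasoning
      regroup : ∀ x y z → x * (y * z) ≡ y * x * z
      regroup = solve-∀
      b^n*2^[1+c]≤n^n : b ^ n * 2 ^ suc c ≤ n ^ n
      b^n*2^[1+c]≤n^n = subst (λ m → b ^ m * 2 ^ suc c ≤ m ^ m) (+-suc b c) (b^[b+d]*2^d≤[b+d]^[b+d] b (suc c))

    private
      e : ℕ
      e = 3 + (c + suc c)

    n^e*n^e≤[2^[1+c]]^t : n ^ 10 ≤ 2 ^ t → n ^ e * n ^ e ≤ (2 ^ suc c) ^ t
    n^e*n^e≤[2^[1+c]]^t n^10≤2^t = begin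
      n ^ e * n ^ e    ≡⟨ ^-distribˡ-+-* n e e ⟨
      n ^ (e + e)      ≤⟨ ^-monoʳ-≤ n (≤-trans (m≤m+n (e + e) (2 + 6 * c)) (≤-reflexive (count c))) ⟩
      n ^ (10 * suc c) ≡⟨ ^-*-assoc n 10 (suc c) ⟨
      (n ^ 10) ^ suc c ≤⟨ ^-monoˡ-≤ (suc c) n^10≤2^t ⟩
      (2 ^ t) ^ suc c  ≡⟨ [m^n]^o≡[m^o]^n 2 t (suc c) ⟩
      (2 ^ suc c) ^ t  ∎
      where
      open ≤-Reasoning
      count : ∀ c → 3 + (c + suc c) + (3 + (c + suc c)) + (2 + 6 * c) ≡ 10 * suc c
      count = solve-∀

    -- For n < 2b: the binomials are at most n^(2c+1). Squaring turns the exponent a ≥ n/2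
    -- into 2a ≥ n, where the previous estimate applies.
    pairs-bound-dense : n ^ 10 ≤ 2 ^ t → n ≤ a + a → n ^ 3 * ((n C a) * (n C b)) * X ≤ (n ^ t) ^ a
    pairs-bound-dense n^10≤2^t n≤2a = begin
      n ^ 3 * ((n C a) * (n C b)) * X ≤⟨ *-monoˡ-≤ X (*-monoʳ-≤ (n ^ 3) (*-mono-≤ Ca≤n^c Cb≤n^[1+c])) ⟩
      n ^ 3 * (n ^ c * n ^ suc c) * X ≡⟨ cong (_* X) (trans (^-distribˡ-+-* n 3 (c + suc c)) (cong (n ^ 3 *_) (^-distribˡ-+-* n c (suc c)))) ⟨
      n ^ e * X                       ≤⟨ m*m≤n*n⇒m≤n squared ⟩
      (n ^ t) ^ a                     ∎
      where
      open ≤-Reasoning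
      Ca≤n^c : n C a ≤ n ^ c
      Ca≤n^c = subst (λ k → n C a ≤ n ^ k) (m+n∸m≡n a c) (nCk≤n^[n∸k] n a)
      Cb≤n^[1+c] : n C b ≤ n ^ suc c
      Cb≤n^[1+c] = subst (λ k → n C b ≤ n ^ k) (trans (cong (_∸ b) (sym (+-suc b c))) (m+n∸m≡n b (suc c))) (nCk≤n^[n∸k] n b)
      interchange : ∀ z x → z * x * (z * x) ≡ z * z * (x * x)
      interchange = solve-∀
      squared : n ^ e * X * (n ^ e * X) ≤ (n ^ t) ^ a * (n ^ t) ^ a
      squared = begin
        n ^ e * X * (n ^ e * X)             ≡⟨ interchange (n ^ e) X ⟩
        n ^ e * n ^ e * (X * X)             ≤⟨ *-monoˡ-≤ (X * X) (n^e*n^e≤[2^[1+c]]^t n^10≤2^t) ⟩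
        (2 ^ suc c) ^ t * (X * X)           ≡⟨ cong ((2 ^ suc c) ^ t *_) (trans (sym (^-distribˡ-+-* (b ^ t) a a)) ([m^n]^o≡[m^o]^n b t (a + a))) ⟩
        (2 ^ suc c) ^ t * (b ^ (a + a)) ^ t ≡⟨ ^-distribʳ-* (2 ^ suc c) (b ^ (a + a)) t ⟨
        (2 ^ suc c * b ^ (a + a)) ^ t       ≤⟨ ^-monoˡ-≤ t (2^[1+c]*b^[2a]≤n^[2a] n≤2a) ⟩
        (n ^ (a + a)) ^ t                   ≡⟨ [m^n]^o≡[m^o]^n n (a + a) t ⟩
        (n ^ t) ^ (a + a)                   ≡⟨ ^-distribˡ-+-* (n ^ t) a a ⟩
        (n ^ t) ^ a * (n ^ t) ^ a           ∎

    pairs-bound : n ^ 10 ≤ 2 ^ t → n ^ 3 * ((n C a) * (n C b)) * X ≤ (n ^ t) ^ a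
    pairs-bound n^10≤2^t with 2 * b ≤? n
    ... | yes 2b≤n = pairs-bound-sparse n^10≤2^t 2b≤n
    ... | no  2b≰n = pairs-bound-dense n^10≤2^t (≤-trans (<⇒≤ (≰⇒> 2b≰n)) (≤-trans (m≤m+n (2 * b) 2) (≤-reflexive (twice b))))
      where
      twice : ∀ b → 2 * b + 2 ≡ suc b + suc b
      twice = solve-∀


module FiniteSums where

  open import Data.Nat
  open import Data.Nat.Properties
  open import Algebra.Properties.CommutativeSemigroup +-commutativeSemigroup using (interchange)
  open import Data.Bool using (if_then_else_)
  open import Data.Fin using (Fin; zero; suc)
  open import Data.List using (List; []; _∷_; _++_; map; length; filter; cartesianProductWith)
  open import Data.List.Properties using (length-map; length-++)
  open import Data.List.Membership.Propositional using (_∈_)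
  import Data.List.Membership.Propositional.Properties as ∈
  open import Data.List.Relation.Unary.Any using (here; there)
  open import Data.List.Relation.Unary.All using (All; []; _∷_)
  open import Data.List.Relation.Unary.All.Properties using (All¬⇒¬Any)
  open import Data.List.Relation.Unary.Unique.Propositional using (Unique; []; _∷_)
  import Data.List.Relation.Unary.Unique.Propositional.Properties as Unique
  open import Data.Vec using (Vec; []; _∷_; updateAt)
  open import Data.Vec.Properties using (∷-injective)
  open import Function using (_∘_)
  open import Level using (Level)
  open import Relation.Binary.Definitions using (DecidableEquality)
  open import Relation.Binary.PropositionalEquality
  open import Relation.Nullary using (¬_; Dec; yes; no; does)
  open import Relation.Nullary.Negation using (contradiction)
  open import Relation.Nullary.Decidable using (¬?)
  open import Relation.Unary using (Pred; Decidable)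

  private
    variable
      a b c p : Level
      A : Set a
      B : Set b
      C : Set c

  ∑ : List A → (A → ℕ) → ℕ
  ∑ []       f = 0
  ∑ (x ∷ xs) f = f x + ∑ xs f

  infix 5 ∑
  syntax ∑ xs (λ x → e) = ∑[ x ← xs ] e

  ∑-cong : ∀ (xs : List A) {f g : A → ℕ} → (∀ x → f x ≡ g x) → ∑ xs f ≡ ∑ xs g
  ∑-cong []       f≗g = refl
  ∑-cong (x ∷ xs) f≗g = cong₂ _+_ (f≗g x) (∑-cong xs f≗g)

  ∑-mono : ∀ (xs : List A) {f g : A → ℕ} → (∀ x → f x ≤ g x) → ∑ xs f ≤ ∑ xs g
  ∑-mono []       f≤g = z≤n
  ∑-mono (x ∷ xs) f≤g = +-mono-≤ (f≤g x) (∑-mono xs f≤g)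

  ∑-++ : ∀ (xs ys : List A) (f : A → ℕ) → ∑ (xs ++ ys) f ≡ ∑ xs f + ∑ ys f
  ∑-++ []       ys f = refl
  ∑-++ (x ∷ xs) ys f = trans (cong (f x +_) (∑-++ xs ys f)) (sym (+-assoc (f x) _ _))

  ∑-distrib-+ : ∀ (xs : List A) (f g : A → ℕ) → ∑[ x ← xs ] (f x + g x) ≡ ∑ xs f + ∑ xs g
  ∑-distrib-+ []       f g = refl
  ∑-distrib-+ (x ∷ xs) f g = trans (cong (f x + g x +_) (∑-distrib-+ xs f g)) (interchange (f x) (g x) _ _)

  *-distribˡ-∑ : ∀ (xs : List A) (k : ℕ) (f : A → ℕ) → ∑[ x ← xs ] k * f x ≡ k * ∑ xs f
  *-distribˡ-∑ []       k f = sym (*-zeroʳ k)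
  *-distribˡ-∑ (x ∷ xs) k f = trans (cong (k * f x +_) (*-distribˡ-∑ xs k f)) (sym (*-distribˡ-+ k (f x) _))

  *-distribʳ-∑ : ∀ (xs : List A) (k : ℕ) (f : A → ℕ) → ∑[ x ← xs ] f x * k ≡ ∑ xs f * k
  *-distribʳ-∑ xs k f = trans (∑-cong xs (λ x → *-comm (f x) k)) (trans (*-distribˡ-∑ xs k f) (*-comm k _))

  ∑-const : ∀ (xs : List A) (k : ℕ) → ∑[ _ ← xs ] k ≡ length xs * k
  ∑-const []       k = refl
  ∑-const (x ∷ xs) k = cong (k +_) (∑-const xs k)

  ∑-map : ∀ (g : A → B) (xs : List A) (f : B → ℕ) → ∑ (map g xs) f ≡ ∑ xs (f ∘ g)
  ∑-map g []       f = refl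
  ∑-map g (x ∷ xs) f = cong (f (g x) +_) (∑-map g xs f)

  ∑-comm : ∀ (xs : List A) (ys : List B) (h : A → B → ℕ) →
           ∑[ x ← xs ] ∑[ y ← ys ] h x y ≡ ∑[ y ← ys ] ∑[ x ← xs ] h x y
  ∑-comm []       ys h = sym (trans (∑-const ys 0) (*-zeroʳ (length ys)))
  ∑-comm (x ∷ xs) ys h = trans (cong (∑ ys (h x) +_) (∑-comm xs ys h)) (sym (∑-distrib-+ ys (h x) _))

  ∑-cartesianProductWith : ∀ (h : A → B → C) (xs : List A) (ys : List B) (f : C → ℕ) →
                           ∑ (cartesianProductWith h xs ys) f ≡ ∑[ x ← xs ] ∑[ y ← ys ] f (h x y)
  ∑-cartesianProductWith h []       ys f = refl
  ∑-cartesianProductWith h (x ∷ xs) ys f = trans (∑-++ (map (h x) ys) _ f)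
    (cong₂ _+_ (∑-map (h x) ys f) (∑-cartesianProductWith h xs ys f))

  length-cartesianProductWith : ∀ (h : A → B → C) (xs : List A) (ys : List B) →
                                length (cartesianProductWith h xs ys) ≡ length xs * length ys
  length-cartesianProductWith h []       ys = refl
  length-cartesianProductWith h (x ∷ xs) ys =
    trans (length-++ (map (h x) ys)) (cong₂ _+_ (length-map (h x) ys) (length-cartesianProductWith h xs ys))

  ∑-product : ∀ (xs : List A) (ys : List B) (f : A → ℕ) (g : B → ℕ) →
              ∑[ x ← xs ] ∑[ y ← ys ] f x * g y ≡ ∑ xs f * ∑ ys g
  ∑-product []       ys f g = refl
  ∑-product (x ∷ xs) ys f g = trans (cong₂ _+_ (*-distribˡ-∑ ys (f x) g) (∑-product xs ys f g))
    (sym (*-distribʳ-+ (∑ ys g) (f x) (∑ xs f)))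

  term≤∑ : ∀ {xs : List A} {x} (f : A → ℕ) → x ∈ xs → f x ≤ ∑ xs f
  term≤∑ f (here refl)           = m≤m+n _ _
  term≤∑ {xs = y ∷ _} f (there x∈xs) = ≤-trans (term≤∑ f x∈xs) (m≤n+m _ (f y))

  𝟙 : {P : Set p} → Dec P → ℕ
  𝟙 P? = if does P? then 1 else 0

  𝟙≤1 : {P : Set p} (P? : Dec P) → 𝟙 P? ≤ 1
  𝟙≤1 (yes _) = ≤-refl
  𝟙≤1 (no _)  = z≤n

  𝟙-yes : {P : Set p} (P? : Dec P) → P → 𝟙 P? ≡ 1
  𝟙-yes (yes _) _ = refl
  𝟙-yes (no ¬p) p = contradiction p ¬p

  𝟙-no : {P : Set p} (P? : Dec P) → ¬ P → 𝟙 P? ≡ 0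
  𝟙-no (yes p) ¬p = contradiction p ¬p
  𝟙-no (no _)  _  = refl

  𝟙+𝟙¬≡1 : {P : Set p} (P? : Dec P) → 𝟙 P? + 𝟙 (¬? P?) ≡ 1
  𝟙+𝟙¬≡1 (yes _) = refl
  𝟙+𝟙¬≡1 (no _)  = refl

  module _ {P : Pred A p} (P? : Decidable P) where

    length-filter≡∑𝟙 : ∀ (xs : List A) → length (filter P? xs) ≡ ∑[ x ← xs ] 𝟙 (P? x)
    length-filter≡∑𝟙 []       = refl
    length-filter≡∑𝟙 (x ∷ xs) with P? x
    ... | yes _ = cong suc (length-filter≡∑𝟙 xs)
    ... | no  _ = length-filter≡∑𝟙 xs

    ∑𝟙≤1 : ∀ (xs : List A) → Unique xs → (∀ x y → P x → P y → x ≡ y) → ∑[ x ← xs ] 𝟙 (P? x) ≤ 1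
    ∑𝟙≤1 []       _              _   = z≤n
    ∑𝟙≤1 (x ∷ xs) (x∉xs ∷ uniq) one with P? x
    ... | no  _  = ∑𝟙≤1 xs uniq one
    ... | yes px = s≤s (≤-reflexive (no-other xs x∉xs))
      where
      no-other : ∀ ys → All (x ≢_) ys → ∑[ y ← ys ] 𝟙 (P? y) ≡ 0
      no-other []       []            = refl
      no-other (y ∷ ys) (x≢y ∷ x∉ys) = cong₂ _+_ (𝟙-no (P? y) (x≢y ∘ one x y px)) (no-other ys x∉ys)

  module _ (_≟_ : DecidableEquality A) where

    ∑-pick : ∀ {xs : List A} {x} (f : A → ℕ) → Unique xs → x ∈ xs → ∑[ y ← xs ] 𝟙 (x ≟ y) * f y ≡ f x
    ∑-pick {xs = x ∷ xs} {x} f (x∉xs ∷ _) (here refl) = begin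
      𝟙 (x ≟ x) * f x + (∑[ y ← xs ] 𝟙 (x ≟ y) * f y) ≡⟨ cong₂ _+_ (cong (_* f x) (𝟙-yes (x ≟ x) refl)) (no-other xs x∉xs) ⟩
      1 * f x + 0                                     ≡⟨ trans (+-identityʳ _) (*-identityˡ (f x)) ⟩
      f x                                             ∎
      where
      open ≡-Reasoning
      no-other : ∀ ys → All (x ≢_) ys → ∑[ y ← ys ] 𝟙 (x ≟ y) * f y ≡ 0
      no-other []       []            = refl
      no-other (y ∷ ys) (x≢y ∷ x∉ys) = cong₂ _+_ (cong (_* f y) (𝟙-no (x ≟ y) x≢y)) (no-other ys x∉ys)
    ∑-pick {xs = z ∷ xs} {x} f (z∉xs ∷ uniq) (there x∈xs) =
      cong₂ _+_ (cong (_* f z) (𝟙-no (x ≟ z) x≢z)) (∑-pick f uniq x∈xs)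
      where
      x≢z : x ≢ z
      x≢z refl = All¬⇒¬Any z∉xs x∈xs

  ∑-fibres : (_≟_ : DecidableEquality B) {ys : List B} → Unique ys → (g : A → B) → (∀ x → g x ∈ ys) →
             ∀ (xs : List A) (f : B → ℕ) → ∑[ x ← xs ] f (g x) ≡ ∑[ b ← ys ] (∑[ x ← xs ] 𝟙 (g x ≟ b)) * f b
  ∑-fibres _≟_ {ys} uniq g g∈ys xs f = begin
    ∑[ x ← xs ] f (g x)                         ≡⟨ ∑-cong xs (λ x → ∑-pick _≟_ f uniq (g∈ys x)) ⟨
    ∑[ x ← xs ] ∑[ b ← ys ] 𝟙 (g x ≟ b) * f b   ≡⟨ ∑-comm xs ys _ ⟩
    ∑[ b ← ys ] ∑[ x ← xs ] 𝟙 (g x ≟ b) * f b   ≡⟨ ∑-cong ys (λ b → *-distribʳ-∑ xs (f b) (λ x → 𝟙 (g x ≟ b))) ⟩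
    ∑[ b ← ys ] (∑[ x ← xs ] 𝟙 (g x ≟ b)) * f b ∎
    where open ≡-Reasoning

  allVecs : List A → ∀ m → List (Vec A m)
  allVecs xs zero    = [] ∷ []
  allVecs xs (suc m) = cartesianProductWith _∷_ xs (allVecs xs m)

  length-allVecs : ∀ (xs : List A) m → length (allVecs xs m) ≡ length xs ^ m
  length-allVecs xs zero    = refl
  length-allVecs xs (suc m) =
    trans (length-cartesianProductWith _∷_ xs (allVecs xs m)) (cong (length xs *_) (length-allVecs xs m))

  allVecs⁺ : ∀ {xs : List A} → Unique xs → ∀ m → Unique (allVecs xs m)
  allVecs⁺ uniq zero    = [] ∷ []
  allVecs⁺ uniq (suc m) = Unique.cartesianProductWith⁺ _∷_ ∷-injective uniq (allVecs⁺ uniq m)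

  ∈-allVecs : ∀ {xs : List A} → (∀ x → x ∈ xs) → ∀ {m} (v : Vec A m) → v ∈ allVecs xs m
  ∈-allVecs complete []      = here refl
  ∈-allVecs complete (x ∷ v) = ∈.∈-cartesianProductWith⁺ _∷_ (complete x) (∈-allVecs complete v)

  -- Resampling xs ys u: drawing x uniformly from xs and y uniformly from ys,
  -- u x y is again uniformly distributed on xs.
  Resampling : {A : Set a} → List A → List B → (A → B → A) → Set a
  Resampling {A = A} xs ys u = ∀ (f : A → ℕ) → length ys * ∑ xs f ≡ ∑[ x ← xs ] ∑[ y ← ys ] f (u x y)

  resampling-replace : ∀ (xs : List A) → Resampling xs xs (λ _ y → y)
  resampling-replace xs f = sym (∑-const xs (∑ xs f))

  resampling-updateAt : ∀ {xs : List A} {ys : List B} {u : A → B → A} → Resampling xs ys u →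
                        ∀ m (k : Fin m) → Resampling (allVecs xs m) ys (λ v y → updateAt v k (λ x → u x y))
  resampling-updateAt {A = A} {xs = xs} {ys} {u} res (suc m) zero f = begin
    length ys * ∑ (cartesianProductWith _∷_ xs V) f                                      ≡⟨ cong (length ys *_) (∑-cartesianProductWith _∷_ xs V f) ⟩
    length ys * (∑[ x ← xs ] ∑[ v ← V ] f (x ∷ v))                                       ≡⟨ cong (length ys *_) (∑-comm xs V _) ⟩
    length ys * (∑[ v ← V ] ∑[ x ← xs ] f (x ∷ v))                                       ≡⟨ *-distribˡ-∑ V (length ys) _ ⟨
    ∑[ v ← V ] length ys * (∑[ x ← xs ] f (x ∷ v))                                       ≡⟨ ∑-cong V (λ v → res (λ x → f (x ∷ v))) ⟩
    ∑[ v ← V ] ∑[ x ← xs ] ∑[ y ← ys ] f (u x y ∷ v)                                     ≡⟨ ∑-comm xs V _ ⟨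
    ∑[ x ← xs ] ∑[ v ← V ] ∑[ y ← ys ] f (u x y ∷ v)                                     ≡⟨ ∑-cartesianProductWith _∷_ xs V _ ⟨
    ∑[ w ← cartesianProductWith _∷_ xs V ] ∑[ y ← ys ] f (updateAt w zero (λ x → u x y)) ∎
    where
    open ≡-Reasoning
    V : List (Vec A m)
    V = allVecs xs m
  resampling-updateAt {A = A} {xs = xs} {ys} {u} res (suc m) (suc k) f = begin
    length ys * ∑ (cartesianProductWith _∷_ xs V) f                                         ≡⟨ cong (length ys *_) (∑-cartesianProductWith _∷_ xs V f) ⟩
    length ys * (∑[ x ← xs ] ∑[ v ← V ] f (x ∷ v))                                          ≡⟨ *-distribˡ-∑ xs (length ys) _ ⟨
    ∑[ x ← xs ] length ys * (∑[ v ← V ] f (x ∷ v))                                          ≡⟨ ∑-cong xs (λ x → resampling-updateAt {ys = ys} {u} res m k (λ v → f (x ∷ v))) ⟩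
    ∑[ x ← xs ] ∑[ v ← V ] ∑[ y ← ys ] f (x ∷ updateAt v k (λ z → u z y))                   ≡⟨ ∑-cartesianProductWith _∷_ xs V _ ⟨
    ∑[ w ← cartesianProductWith _∷_ xs V ] ∑[ y ← ys ] f (updateAt w (suc k) (λ x → u x y)) ∎
    where
    open ≡-Reasoning
    V : List (Vec A m)
    V = allVecs xs m


module Hall where

  open import Data.Nat using (ℕ; zero; suc; _+_; _≤_; _<_; z≤n; s≤s; _≤?_; _<?_; ≤-pred)
  open import Data.Nat.Properties
    using (≤-trans; ≤-reflexive; ≤-antisym; ≮⇒≥; n≤1+n; +-suc; +-comm; +-monoˡ-<; ≤-<-trans; n≤0⇒n≡0; <⇒≢; module ≤-Reasoning)
  open import Data.Bool using (if_then_else_)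
  open import Data.Fin using (Fin; zero; suc; _≟_)
  open import Data.Fin.Subset
  open import Data.Fin.Subset.Properties
  open import Data.Vec using ([]; _∷_; here; there)
  open import Data.Product using (Σ; _×_; _,_; ∃)
  open import Data.Sum using (_⊎_; inj₁; inj₂; [_,_]′)
  open import Function using (_∘_)
  open import Relation.Binary.PropositionalEquality
  open import Relation.Nullary using (yes; no; does; _×-dec_)
  open import Relation.Nullary.Negation using (contradiction)

  private
    variable
      m n : ℕ

  x∈p─q⇒x∉q : ∀ {x : Fin n} {p q : Subset n} → x ∈ p ─ q → x ∉ q
  x∈p─q⇒x∉q {x = zero}  {_ ∷ _} {outside ∷ _} _ ()
  x∈p─q⇒x∉q {x = zero}  {_ ∷ _} {inside ∷ _}  ()
  x∈p─q⇒x∉q {x = suc x} {_ ∷ _} {_ ∷ _} (there x∈p─q) (there x∈q) = x∈p─q⇒x∉q x∈p─q x∈q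

  ∣p∪q∣≤∣p∣+∣q∣ : ∀ (p q : Subset n) → ∣ p ∪ q ∣ ≤ ∣ p ∣ + ∣ q ∣
  ∣p∪q∣≤∣p∣+∣q∣ []            []            = z≤n
  ∣p∪q∣≤∣p∣+∣q∣ (outside ∷ p) (outside ∷ q) = ∣p∪q∣≤∣p∣+∣q∣ p q
  ∣p∪q∣≤∣p∣+∣q∣ (outside ∷ p) (inside ∷ q)  = ≤-trans (s≤s (∣p∪q∣≤∣p∣+∣q∣ p q)) (≤-reflexive (sym (+-suc ∣ p ∣ ∣ q ∣)))
  ∣p∪q∣≤∣p∣+∣q∣ (inside ∷ p)  (outside ∷ q) = s≤s (∣p∪q∣≤∣p∣+∣q∣ p q)
  ∣p∪q∣≤∣p∣+∣q∣ (inside ∷ p)  (inside ∷ q)  =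
    s≤s (≤-trans (∣p∪q∣≤∣p∣+∣q∣ p q) (≤-trans (n≤1+n _) (≤-reflexive (sym (+-suc ∣ p ∣ ∣ q ∣)))))

  disjoint-tail : ∀ {s t} {p q : Subset n} → (∀ {x} → x ∈ s ∷ p → x ∉ t ∷ q) → ∀ {x} → x ∈ p → x ∉ q
  disjoint-tail disjoint x∈p x∈q = disjoint (there x∈p) (there x∈q)

  disjoint⇒∣p∣+∣q∣≤∣p∪q∣ : ∀ (p q : Subset n) → (∀ {x} → x ∈ p → x ∉ q) → ∣ p ∣ + ∣ q ∣ ≤ ∣ p ∪ q ∣
  disjoint⇒∣p∣+∣q∣≤∣p∪q∣ []            []            _        = z≤n
  disjoint⇒∣p∣+∣q∣≤∣p∪q∣ (inside ∷ p)  (inside ∷ q)  disjoint = contradiction here (disjoint here)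
  disjoint⇒∣p∣+∣q∣≤∣p∪q∣ (outside ∷ p) (outside ∷ q) disjoint = disjoint⇒∣p∣+∣q∣≤∣p∪q∣ p q (disjoint-tail disjoint)
  disjoint⇒∣p∣+∣q∣≤∣p∪q∣ (inside ∷ p)  (outside ∷ q) disjoint = s≤s (disjoint⇒∣p∣+∣q∣≤∣p∪q∣ p q (disjoint-tail disjoint))
  disjoint⇒∣p∣+∣q∣≤∣p∪q∣ (outside ∷ p) (inside ∷ q)  disjoint =
    ≤-trans (≤-reflexive (+-suc ∣ p ∣ ∣ q ∣)) (s≤s (disjoint⇒∣p∣+∣q∣≤∣p∪q∣ p q (disjoint-tail disjoint)))

  ∣p∣>0⇒Nonempty : ∀ (p : Subset n) → 0 < ∣ p ∣ → Nonempty p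
  ∣p∣>0⇒Nonempty (inside ∷ p)  _     = zero , here
  ∣p∣>0⇒Nonempty (outside ∷ p) ∣p∣>0 with ∣p∣>0⇒Nonempty p ∣p∣>0
  ... | x , x∈p = suc x , there x∈p

  Empty⇒∣p∣≡0 : ∀ (p : Subset n) → Empty p → ∣ p ∣ ≡ 0
  Empty⇒∣p∣≡0 {n} p p-empty = trans (cong ∣_∣ (Empty-unique p-empty)) (∣⊥∣≡0 n)

  neighbourhood : (Fin m → Subset n) → Subset m → Subset n
  neighbourhood {zero}  F []            = ⊥
  neighbourhood {suc m} F (inside ∷ A)  = F zero ∪ neighbourhood (F ∘ suc) A
  neighbourhood {suc m} F (outside ∷ A) = neighbourhood (F ∘ suc) A

  ∈-neighbourhood⁺ : ∀ (F : Fin m → Subset n) {A i x} → i ∈ A → x ∈ F i → x ∈ neighbourhood F A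
  ∈-neighbourhood⁺ F {inside ∷ A}  {zero}  here         x∈Fi = x∈p∪q⁺ (inj₁ x∈Fi)
  ∈-neighbourhood⁺ F {inside ∷ A}  {suc i} (there i∈A) x∈Fi = x∈p∪q⁺ (inj₂ (∈-neighbourhood⁺ (F ∘ suc) i∈A x∈Fi))
  ∈-neighbourhood⁺ F {outside ∷ A} {suc i} (there i∈A) x∈Fi = ∈-neighbourhood⁺ (F ∘ suc) i∈A x∈Fi

  ∈-neighbourhood⁻ : ∀ (F : Fin m → Subset n) A {x} → x ∈ neighbourhood F A → ∃ λ i → i ∈ A × x ∈ F i
  ∈-neighbourhood⁻ {zero}  F []            x∈N = contradiction x∈N ∉⊥
  ∈-neighbourhood⁻ {suc m} F (inside ∷ A)  x∈N with x∈p∪q⁻ (F zero) _ x∈N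
  ... | inj₁ x∈F0 = zero , here , x∈F0
  ... | inj₂ x∈N′ with ∈-neighbourhood⁻ (F ∘ suc) A x∈N′
  ...   | i , i∈A , x∈Fi = suc i , there i∈A , x∈Fi
  ∈-neighbourhood⁻ {suc m} F (outside ∷ A) x∈N with ∈-neighbourhood⁻ (F ∘ suc) A x∈N
  ... | i , i∈A , x∈Fi = suc i , there i∈A , x∈Fi

  -- σ is unconstrained outside R.
  SDR : (Fin m → Subset n) → Subset m → Set
  SDR {m} {n} F R = Σ (Fin m → Fin n) λ σ →
    (∀ {i} → i ∈ R → σ i ∈ F i) × (∀ {i j} → i ∈ R → j ∈ R → σ i ≡ σ j → i ≡ j)

  Deficient : (Fin m → Subset n) → Subset m → Set
  Deficient F R = ∃ λ A → A ⊆ R × ∣ neighbourhood F A ∣ < ∣ A ∣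

  module _ (F : Fin m → Subset n) where

    deficient-⊆ : ∀ {R R′} → R ⊆ R′ → Deficient F R → Deficient F R′
    deficient-⊆ R⊆R′ (A , A⊆R , def) = A , ⊆-trans A⊆R R⊆R′ , def

    -- Rows of a critical set A (|N(A)| = |A|) use up all of N(A); the other rows
    -- are matched, or shown deficient, in the family with N(A) removed.
    module Critical {R A} (A⊆R : A ⊆ R) (critical : ∣ neighbourhood F A ∣ ≡ ∣ A ∣) where

      private
        X : Subset n
        X = neighbourhood F A
        F′ : Fin m → Subset n
        F′ i = F i ─ X

      deficient-∪ : Deficient F′ (R ─ A) → Deficient F R
      deficient-∪ (A′ , A′⊆R─A , def) = A′ ∪ A , A′∪A⊆R , (begin-strict
        ∣ neighbourhood F (A′ ∪ A) ∣    ≤⟨ p⊆q⇒∣p∣≤∣q∣ N⊆ ⟩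
        ∣ neighbourhood F′ A′ ∪ X ∣     ≤⟨ ∣p∪q∣≤∣p∣+∣q∣ (neighbourhood F′ A′) X ⟩
        ∣ neighbourhood F′ A′ ∣ + ∣ X ∣ <⟨ +-monoˡ-< ∣ X ∣ def ⟩
        ∣ A′ ∣ + ∣ X ∣                  ≡⟨ cong (∣ A′ ∣ +_) critical ⟩
        ∣ A′ ∣ + ∣ A ∣                  ≤⟨ disjoint⇒∣p∣+∣q∣≤∣p∪q∣ A′ A (x∈p─q⇒x∉q {p = R} ∘ A′⊆R─A) ⟩
        ∣ A′ ∪ A ∣                      ∎)
        where
        open ≤-Reasoning
        A′∪A⊆R : A′ ∪ A ⊆ R
        A′∪A⊆R i∈A′∪A with x∈p∪q⁻ A′ A i∈A′∪A
        ... | inj₁ i∈A′ = p─q⊆p R A (A′⊆R─A i∈A′)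
        ... | inj₂ i∈A  = A⊆R i∈A
        N⊆ : neighbourhood F (A′ ∪ A) ⊆ neighbourhood F′ A′ ∪ X
        N⊆ {x} x∈N with ∈-neighbourhood⁻ F (A′ ∪ A) x∈N
        ... | i , i∈A′∪A , x∈Fi with x∈p∪q⁻ A′ A i∈A′∪A | x ∈? X
        ...   | _          | yes x∈X = x∈p∪q⁺ (inj₂ x∈X)
        ...   | inj₂ i∈A   | no  _   = x∈p∪q⁺ (inj₂ (∈-neighbourhood⁺ F i∈A x∈Fi))
        ...   | inj₁ i∈A′  | no  x∉X = x∈p∪q⁺ (inj₁ (∈-neighbourhood⁺ F′ i∈A′ (x∈p∧x∉q⇒x∈p─q x∈Fi x∉X)))

      glue : SDR F A → SDR F′ (R ─ A) → SDR F R
      glue (σ₁ , σ₁∈F , σ₁-inj) (σ₂ , σ₂∈F′ , σ₂-inj) = σ , σ∈F , σ-inj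
        where
        σ : Fin m → Fin n
        σ i = if does (i ∈? A) then σ₁ i else σ₂ i
        σ∈F : ∀ {i} → i ∈ R → σ i ∈ F i
        σ∈F {i} i∈R with i ∈? A
        ... | yes i∈A = σ₁∈F i∈A
        ... | no  i∉A = p─q⊆p (F i) X (σ₂∈F′ (x∈p∧x∉q⇒x∈p─q i∈R i∉A))
        apart : ∀ {i j} → i ∈ A → j ∈ R → j ∉ A → σ₁ i ≢ σ₂ j
        apart {i} {j} i∈A j∈R j∉A eq =
          x∈p─q⇒x∉q {p = F j} (σ₂∈F′ (x∈p∧x∉q⇒x∈p─q j∈R j∉A)) (subst (_∈ X) eq (∈-neighbourhood⁺ F i∈A (σ₁∈F i∈A)))
        σ-inj : ∀ {i j} → i ∈ R → j ∈ R → σ i ≡ σ j → i ≡ j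
        σ-inj {i} {j} i∈R j∈R with i ∈? A | j ∈? A
        ... | yes i∈A | yes j∈A = σ₁-inj i∈A j∈A
        ... | yes i∈A | no  j∉A = λ eq → contradiction eq (apart i∈A j∈R j∉A)
        ... | no  i∉A | yes j∈A = λ eq → contradiction (sym eq) (apart j∈A i∈R i∉A)
        ... | no  i∉A | no  j∉A = σ₂-inj (x∈p∧x∉q⇒x∈p─q i∈R i∉A) (x∈p∧x∉q⇒x∈p─q j∈R j∉A)

      combine : SDR F A ⊎ Deficient F A → SDR F′ (R ─ A) ⊎ Deficient F′ (R ─ A) → SDR F R ⊎ Deficient F R
      combine (inj₂ def) _          = inj₂ (deficient-⊆ A⊆R def)
      combine (inj₁ σ₁)  (inj₂ def) = inj₂ (deficient-∪ def)
      combine (inj₁ σ₁)  (inj₁ σ₂)  = inj₁ (glue σ₁ σ₂)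

    -- When every nonempty A ⊆ R - r has |N(A)| > |A|, row r may take any x ∈ F r.
    module Surplus {R r x} (r∈R : r ∈ R) (x∈Fr : x ∈ F r) where

      private
        F′ : Fin m → Subset n
        F′ i = F i - x

      extend : SDR F′ (R - r) → SDR F R
      extend (σ′ , σ′∈F′ , σ′-inj) = σ , σ∈F , σ-inj
        where
        σ : Fin m → Fin n
        σ i = if does (i ≟ r) then x else σ′ i
        σ∈F : ∀ {i} → i ∈ R → σ i ∈ F i
        σ∈F {i} i∈R with i ≟ r
        ... | yes refl = x∈Fr
        ... | no  i≢r  = p─q⊆p (F i) ⁅ x ⁆ (σ′∈F′ (x∈p∧x≢y⇒x∈p-y i∈R i≢r))
        apart : ∀ {j} → j ∈ R → j ≢ r → x ≢ σ′ j
        apart {j} j∈R j≢r eq = x∈p─q⇒x∉q {p = F j} (σ′∈F′ (x∈p∧x≢y⇒x∈p-y j∈R j≢r)) (subst (_∈ ⁅ x ⁆) eq (x∈⁅x⁆ x))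
        σ-inj : ∀ {i j} → i ∈ R → j ∈ R → σ i ≡ σ j → i ≡ j
        σ-inj {i} {j} i∈R j∈R with i ≟ r | j ≟ r
        ... | yes refl | yes refl = λ _ → refl
        ... | yes refl | no  j≢r  = λ eq → contradiction eq (apart j∈R j≢r)
        ... | no  i≢r  | yes refl = λ eq → contradiction (sym eq) (apart i∈R i≢r)
        ... | no  i≢r  | no  j≢r  = σ′-inj (x∈p∧x≢y⇒x∈p-y i∈R i≢r) (x∈p∧x≢y⇒x∈p-y j∈R j≢r)

      tight : Deficient F′ (R - r) → ∃ λ A → Nonempty A × A ⊆ R - r × ∣ neighbourhood F A ∣ ≤ ∣ A ∣
      tight (A , A⊆R-r , def) = A , ∣p∣>0⇒Nonempty A (≤-<-trans z≤n def) , A⊆R-r , (begin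
        ∣ neighbourhood F A ∣              ≤⟨ p⊆q⇒∣p∣≤∣q∣ N⊆ ⟩
        ∣ neighbourhood F′ A ∪ ⁅ x ⁆ ∣     ≤⟨ ∣p∪q∣≤∣p∣+∣q∣ (neighbourhood F′ A) ⁅ x ⁆ ⟩
        ∣ neighbourhood F′ A ∣ + ∣ ⁅ x ⁆ ∣ ≡⟨ cong (∣ neighbourhood F′ A ∣ +_) (∣⁅x⁆∣≡1 x) ⟩
        ∣ neighbourhood F′ A ∣ + 1         ≡⟨ +-comm _ 1 ⟩
        suc ∣ neighbourhood F′ A ∣         ≤⟨ def ⟩
        ∣ A ∣                              ∎)
        where
        open ≤-Reasoning
        N⊆ : neighbourhood F A ⊆ neighbourhood F′ A ∪ ⁅ x ⁆
        N⊆ {y} y∈N with ∈-neighbourhood⁻ F A y∈N | y ≟ x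
        ... | _ , _ , _       | yes refl = x∈p∪q⁺ (inj₂ (x∈⁅x⁆ x))
        ... | i , i∈A , y∈Fi | no  y≢x  = x∈p∪q⁺ (inj₁ (∈-neighbourhood⁺ F′ i∈A (x∈p∧x≢y⇒x∈p-y y∈Fi y≢x)))

    deficient-singleton : ∀ {R r} → r ∈ R → Empty (F r) → Deficient F R
    deficient-singleton {R} {r} r∈R Fr-empty = ⁅ r ⁆ , ⁅r⁆⊆R , (begin-strict
      ∣ neighbourhood F ⁅ r ⁆ ∣ ≤⟨ p⊆q⇒∣p∣≤∣q∣ N⊆Fr ⟩
      ∣ F r ∣                   ≡⟨ Empty⇒∣p∣≡0 (F r) Fr-empty ⟩
      0                         <⟨ s≤s z≤n ⟩
      1                         ≡⟨ ∣⁅x⁆∣≡1 r ⟨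
      ∣ ⁅ r ⁆ ∣                 ∎)
      where
      open ≤-Reasoning
      ⁅r⁆⊆R : ⁅ r ⁆ ⊆ R
      ⁅r⁆⊆R i∈⁅r⁆ = subst (_∈ R) (sym (x∈⁅y⁆⇒x≡y r i∈⁅r⁆)) r∈R
      N⊆Fr : neighbourhood F ⁅ r ⁆ ⊆ F r
      N⊆Fr x∈N with ∈-neighbourhood⁻ F ⁅ r ⁆ x∈N
      ... | i , i∈⁅r⁆ , x∈Fi = subst (λ j → _ ∈ F j) (x∈⁅y⁆⇒x≡y r i∈⁅r⁆) x∈Fi

    sdr-empty : ∀ {R} → Fin n → Empty R → SDR F R
    sdr-empty d R-empty = (λ _ → d) , (λ i∈R → contradiction (_ , i∈R) R-empty) , (λ i∈R _ _ → contradiction (_ , i∈R) R-empty)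

  hall : Fin n → (F : Fin m → Subset n) (R : Subset m) → SDR F R ⊎ Deficient F R
  hall {n} d F R = hall-≤ _ F R (∣p∣≤n R)
    where
    hall-≤ : ∀ {m} k (F : Fin m → Subset n) R → ∣ R ∣ ≤ k → SDR F R ⊎ Deficient F R
    hall-≤ zero    F R ∣R∣≤0 = inj₁ (sdr-empty F d λ (i , i∈R) → contradiction (≤-trans (x∈p⇒∣p-x∣<∣p∣ i∈R) ∣R∣≤0) λ ())
    hall-≤ (suc k) F R ∣R∣≤1+k with nonempty? R
    ... | no  R-empty = inj₁ (sdr-empty F d R-empty)
    ... | yes (r , r∈R) with anySubset? (λ A → nonempty? A ×-dec A ⊆? (R - r) ×-dec ∣ neighbourhood F A ∣ ≤? ∣ A ∣)
    ...   | yes (A , (a , a∈A) , A⊆R-r , ∣NA∣≤∣A∣) with ∣ neighbourhood F A ∣ <? ∣ A ∣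
    ...     | yes def = inj₂ (A , ⊆-trans A⊆R-r (p─q⊆p R ⁅ r ⁆) , def)
    ...     | no  ¬def = Critical.combine F A⊆R (≤-antisym ∣NA∣≤∣A∣ (≮⇒≥ ¬def))
                           (hall-≤ k F A (≤-trans (p⊆q⇒∣p∣≤∣q∣ A⊆R-r) ∣R-r∣≤k))
                           (hall-≤ k _ (R ─ A) (≤-pred (≤-trans (p∩q≢∅⇒∣p─q∣<∣p∣ R A (a , x∈p∩q⁺ (A⊆R a∈A , a∈A))) ∣R∣≤1+k)))
      where
      A⊆R : A ⊆ R
      A⊆R = ⊆-trans A⊆R-r (p─q⊆p R ⁅ r ⁆)
      ∣R-r∣≤k : ∣ R - r ∣ ≤ k
      ∣R-r∣≤k = ≤-pred (≤-trans (x∈p⇒∣p-x∣<∣p∣ r∈R) ∣R∣≤1+k)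
    hall-≤ (suc k) F R ∣R∣≤1+k | yes (r , r∈R) | no no-tight-set with nonempty? (F r)
    ...     | no  Fr-empty = inj₂ (deficient-singleton F r∈R Fr-empty)
    ...     | yes (x , x∈Fr) =
      [ inj₁ ∘ Surplus.extend F r∈R x∈Fr , (λ def → contradiction (Surplus.tight F r∈R x∈Fr def) no-tight-set) ]′
        (hall-≤ k _ (R - r) (≤-pred (≤-trans (x∈p⇒∣p-x∣<∣p∣ r∈R) ∣R∣≤1+k)))


module DeficientPositions where

  open import Data.Nat
  open import Data.Nat.Properties
  open import Algebra.Properties.CommutativeSemigroup *-commutativeSemigroup using (x∙yz≈y∙xz)
  open import Data.Nat.Combinatorics using (_C_; nCk+nC[k+1]≡[n+1]C[k+1]; k>n⇒nCk≡0)
  open import Data.Nat.Tactic.RingSolver using (solve-∀)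
  open import Data.Fin using (Fin; zero; suc)
  open import Data.Fin.Subset using (Subset; _∈_; _⊆_; ∣_∣; ⊤; ⊥; ⁅_⁆; _∪_; inside; outside)
  open import Data.Fin.Subset.Properties
    using (_∈?_; _⊆?_; ∣p∣≤n; ∣⊤∣≡n; ⊆⊤; ∉⊥; x∈p∪q⁺; x∈p∪q⁻; x∈⁅x⁆; x∈⁅y⁆⇒x≡y; anySubset?)
  open import Data.List using (List; []; _∷_; allFin; upTo; length; cartesianProductWith)
  open import Data.List.Properties using (map-tabulate; length-upTo; length-tabulate)
  open import Data.List.Membership.Propositional using () renaming (_∈_ to _∈ₗ_)
  open import Data.List.Membership.Propositional.Properties using (∈-upTo⁺)
  open import Data.List.Relation.Unary.Any using (here; there)
  open import Data.List.Relation.Unary.Unique.Propositional.Properties using (upTo⁺)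
  open import Data.Vec using (Vec; []; _∷_; lookup; here; there)
  open import Data.Product using (_×_; _,_; ∃)
  open import Data.Sum using (inj₁; inj₂)
  open import Function using (id; _∘_)
  open import Relation.Binary.PropositionalEquality
  open import Relation.Nullary using (Dec; yes; no; _×-dec_)
  open import Relation.Nullary.Negation using (contradiction)

  open Arithmetic
  open FiniteSums
  open Hall

  private
    variable
      m n t : ℕ

  rowSet : Vec (Fin n) t → Subset n
  rowSet []      = ⊥
  rowSet (x ∷ r) = ⁅ x ⁆ ∪ rowSet r

  ∈-rowSet⁺ : ∀ (r : Vec (Fin n) t) s → lookup r s ∈ rowSet r
  ∈-rowSet⁺ (x ∷ r) zero    = x∈p∪q⁺ (inj₁ (x∈⁅x⁆ x))
  ∈-rowSet⁺ (x ∷ r) (suc s) = x∈p∪q⁺ (inj₂ (∈-rowSet⁺ r s))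

  ∈-rowSet⁻ : ∀ (r : Vec (Fin n) t) {j} → j ∈ rowSet r → ∃ λ s → lookup r s ≡ j
  ∈-rowSet⁻ []      j∈r = contradiction j∈r ∉⊥
  ∈-rowSet⁻ (x ∷ r) j∈r with x∈p∪q⁻ ⁅ x ⁆ (rowSet r) j∈r
  ... | inj₁ j∈⁅x⁆ = zero , sym (x∈⁅y⁆⇒x≡y x j∈⁅x⁆)
  ... | inj₂ j∈r′ with ∈-rowSet⁻ r j∈r′
  ...   | s , eq = suc s , eq

  Positions : ℕ → ℕ → ℕ → Set
  Positions m n t = Vec (Vec (Fin n) t) m

  hits : Positions m n t → Fin m → Subset n
  hits pos i = rowSet (lookup pos i)

  allPositions : ∀ m n t → List (Positions m n t)
  allPositions m n t = allVecs (allVecs (allFin n) t) m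

  length-allFin : ∀ n → length (allFin n) ≡ n
  length-allFin n = length-tabulate {n = n} id

  ∑-allFin : ∀ n (f : Fin (suc n) → ℕ) → ∑ (allFin (suc n)) f ≡ f zero + ∑ (allFin n) (f ∘ suc)
  ∑-allFin n f = cong (f zero +_) (trans (cong (λ xs → ∑ xs f) (sym (map-tabulate id suc))) (∑-map suc (allFin n) f))

  ∑-allFin-∈? : ∀ (B : Subset n) → ∑[ x ← allFin n ] 𝟙 (x ∈? B) ≡ ∣ B ∣
  ∑-allFin-∈? {zero}  []            = refl
  ∑-allFin-∈? {suc n} (inside ∷ B)  = trans (∑-allFin n (λ x → 𝟙 (x ∈? (inside ∷ B)))) (cong suc (∑-allFin-∈? B))
  ∑-allFin-∈? {suc n} (outside ∷ B) = trans (∑-allFin n (λ x → 𝟙 (x ∈? (outside ∷ B)))) (∑-allFin-∈? B)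

  allSubsets : ∀ n → List (Subset n)
  allSubsets = allVecs (outside ∷ inside ∷ [])

  ∈-allSubsets : ∀ (A : Subset n) → A ∈ₗ allSubsets n
  ∈-allSubsets = ∈-allVecs λ { outside → here refl ; inside → there (here refl) }

  ∑-allSubsets-𝟙≡C : ∀ n a → ∑[ A ← allSubsets n ] 𝟙 (∣ A ∣ ≟ a) ≡ n C a
  ∑-allSubsets-𝟙≡C zero    zero    = refl
  ∑-allSubsets-𝟙≡C zero    (suc a) = refl
  ∑-allSubsets-𝟙≡C (suc n) a =
    trans (∑-cartesianProductWith _∷_ (outside ∷ inside ∷ []) (allSubsets n) (λ A → 𝟙 (∣ A ∣ ≟ a)))
          (trans (cong (_+_ (∑[ A ← allSubsets n ] 𝟙 (∣ A ∣ ≟ a))) (+-identityʳ _)) (pascal a))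
    where
    pascal : ∀ a → (∑[ A ← allSubsets n ] 𝟙 (∣ A ∣ ≟ a)) + (∑[ A ← allSubsets n ] 𝟙 (suc ∣ A ∣ ≟ a)) ≡ suc n C a
    pascal zero    = cong₂ _+_ (∑-allSubsets-𝟙≡C n 0) (trans (∑-const (allSubsets n) 0) (*-zeroʳ (length (allSubsets n))))
    pascal (suc a) = trans (cong₂ _+_ (∑-allSubsets-𝟙≡C n (suc a)) (∑-allSubsets-𝟙≡C n a))
                           (trans (+-comm (n C suc a) (n C a)) (nCk+nC[k+1]≡[n+1]C[k+1] n a))

  ∑-by-size : ∀ n (g : ℕ → ℕ) → ∑[ A ← allSubsets n ] g ∣ A ∣ ≡ ∑[ a ← upTo (suc n) ] (n C a) * g a
  ∑-by-size n g = trans (∑-fibres _≟_ (upTo⁺ (suc n)) ∣_∣ (λ A → ∈-upTo⁺ (s≤s (∣p∣≤n A))) (allSubsets n) g)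
                        (∑-cong (upTo (suc n)) (λ a → cong (_* g a) (∑-allSubsets-𝟙≡C n a)))

  confinedTo : Subset n → Vec (Fin n) t → ℕ
  confinedTo B []      = 1
  confinedTo B (x ∷ r) = 𝟙 (x ∈? B) * confinedTo B r

  rowsConfined : Subset m → Subset n → Positions m n t → ℕ
  rowsConfined []            B []        = 1
  rowsConfined (inside ∷ A)  B (r ∷ pos) = confinedTo B r * rowsConfined A B pos
  rowsConfined (outside ∷ A) B (r ∷ pos) = rowsConfined A B pos

  confinedTo≡1 : ∀ (B : Subset n) (r : Vec (Fin n) t) → (∀ s → lookup r s ∈ B) → confinedTo B r ≡ 1
  confinedTo≡1 B []      _   = refl
  confinedTo≡1 B (x ∷ r) r⊆B = cong₂ _*_ (𝟙-yes (x ∈? B) (r⊆B zero)) (confinedTo≡1 B r (r⊆B ∘ suc))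

  rowsConfined≡1 : ∀ (A : Subset m) (B : Subset n) (pos : Positions m n t) →
                   (∀ {i} → i ∈ A → ∀ s → lookup (lookup pos i) s ∈ B) → rowsConfined A B pos ≡ 1
  rowsConfined≡1 []            B []        _     = refl
  rowsConfined≡1 (inside ∷ A)  B (r ∷ pos) A→B = cong₂ _*_ (confinedTo≡1 B r (A→B here)) (rowsConfined≡1 A B pos (A→B ∘ there))
  rowsConfined≡1 (outside ∷ A) B (r ∷ pos) A→B = rowsConfined≡1 A B pos (A→B ∘ there)

  ∑-confinedTo : ∀ t (B : Subset n) → ∑[ r ← allVecs (allFin n) t ] confinedTo B r ≡ ∣ B ∣ ^ t
  ∑-confinedTo zero    B = refl
  ∑-confinedTo {n} (suc t) B = begin
    ∑ (allVecs (allFin n) (suc t)) (confinedTo B)            ≡⟨ ∑-cartesianProductWith _∷_ (allFin n) R (confinedTo B) ⟩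
    ∑[ x ← allFin n ] ∑[ r ← R ] 𝟙 (x ∈? B) * confinedTo B r ≡⟨ ∑-product (allFin n) R (λ x → 𝟙 (x ∈? B)) (confinedTo B) ⟩
    (∑[ x ← allFin n ] 𝟙 (x ∈? B)) * ∑ R (confinedTo B)      ≡⟨ cong₂ _*_ (∑-allFin-∈? B) (∑-confinedTo t B) ⟩
    ∣ B ∣ * ∣ B ∣ ^ t                                        ∎
    where
    open ≡-Reasoning
    R : List (Vec (Fin n) t)
    R = allVecs (allFin n) t

  length-allVecs-allFin : ∀ n t → length (allVecs (allFin n) t) ≡ n ^ t
  length-allVecs-allFin n t = trans (length-allVecs (allFin n) t) (cong (_^ t) (length-allFin n))

  length-allPositions : ∀ m n t → length (allPositions m n t) ≡ (n ^ t) ^ m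
  length-allPositions m n t = trans (length-allVecs (allVecs (allFin n) t) m) (cong (_^ m) (length-allVecs-allFin n t))

  ∑-rowsConfined : ∀ m (A : Subset m) (B : Subset n) →
                   ∑[ pos ← allPositions m n t ] rowsConfined A B pos ≡ (∣ B ∣ ^ t) ^ ∣ A ∣ * (n ^ t) ^ (m ∸ ∣ A ∣)
  ∑-rowsConfined zero    []            B = refl
  ∑-rowsConfined {n} {t} (suc m) (inside ∷ A) B = begin
    ∑ (cartesianProductWith _∷_ R P) (rowsConfined (inside ∷ A) B) ≡⟨ ∑-cartesianProductWith _∷_ R P _ ⟩
    ∑[ r ← R ] ∑[ pos ← P ] confinedTo B r * rowsConfined A B pos  ≡⟨ ∑-product R P (confinedTo B) (rowsConfined A B) ⟩
    ∑ R (confinedTo B) * ∑ P (rowsConfined A B)                    ≡⟨ cong₂ _*_ (∑-confinedTo t B) (∑-rowsConfined m A B) ⟩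
    ∣ B ∣ ^ t * ((∣ B ∣ ^ t) ^ ∣ A ∣ * (n ^ t) ^ (m ∸ ∣ A ∣))      ≡⟨ *-assoc (∣ B ∣ ^ t) _ _ ⟨
    (∣ B ∣ ^ t) ^ suc ∣ A ∣ * (n ^ t) ^ (m ∸ ∣ A ∣)                ∎
    where
    open ≡-Reasoning
    R : List (Vec (Fin n) t)
    R = allVecs (allFin n) t
    P : List (Positions m n t)
    P = allPositions m n t
  ∑-rowsConfined {n} {t} (suc m) (outside ∷ A) B = begin
    ∑ (cartesianProductWith _∷_ R P) (rowsConfined (outside ∷ A) B) ≡⟨ ∑-cartesianProductWith _∷_ R P _ ⟩
    ∑[ r ← R ] ∑ P (rowsConfined A B)                               ≡⟨ ∑-const R _ ⟩
    length R * ∑ P (rowsConfined A B)                               ≡⟨ cong₂ _*_ (length-allVecs-allFin n t) (∑-rowsConfined m A B) ⟩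
    n ^ t * (X ^ ∣ A ∣ * (n ^ t) ^ (m ∸ ∣ A ∣))                     ≡⟨ x∙yz≈y∙xz (n ^ t) (X ^ ∣ A ∣) _ ⟩
    X ^ ∣ A ∣ * (n ^ t) ^ suc (m ∸ ∣ A ∣)                           ≡⟨ cong (λ e → X ^ ∣ A ∣ * (n ^ t) ^ e) (+-∸-assoc 1 (∣p∣≤n A)) ⟨
    X ^ ∣ A ∣ * (n ^ t) ^ (suc m ∸ ∣ A ∣)                           ∎
    where
    open ≡-Reasoning
    R : List (Vec (Fin n) t)
    R = allVecs (allFin n) t
    P : List (Positions m n t)
    P = allPositions m n t
    X : ℕ
    X = ∣ B ∣ ^ t

  ∃-superset-of-size : ∀ (X : Subset n) j → ∣ X ∣ ≤ j → j ≤ n → ∃ λ B → X ⊆ B × ∣ B ∣ ≡ j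
  ∃-superset-of-size []            zero    _            _   = [] , id , refl
  ∃-superset-of-size (inside ∷ X)  (suc j) (s≤s ∣X∣≤j) (s≤s j≤n) with ∃-superset-of-size X j ∣X∣≤j j≤n
  ... | B , X⊆B , ∣B∣≡j = inside ∷ B , (λ { here → here ; (there x∈X) → there (X⊆B x∈X) }) , cong suc ∣B∣≡j
  ∃-superset-of-size {suc n} (outside ∷ X) j ∣X∣≤j j≤1+n with j ≤? n
  ... | yes j≤n with ∃-superset-of-size X j ∣X∣≤j j≤n
  ...   | B , X⊆B , ∣B∣≡j = outside ∷ B , (λ { (there x∈X) → there (X⊆B x∈X) }) , ∣B∣≡j
  ∃-superset-of-size {suc n} (outside ∷ X) j ∣X∣≤j j≤1+n | no j≰n =
    ⊤ , ⊆⊤ , trans (∣⊤∣≡n (suc n)) (≤-antisym (≰⇒> j≰n) j≤1+n)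

  deficient? : (pos : Positions m n t) → Dec (Deficient (hits pos) ⊤)
  deficient? pos = anySubset? (λ A → A ⊆? ⊤ ×-dec ∣ neighbourhood (hits pos) A ∣ <? ∣ A ∣)

  -- Every deficient A has some B ⊇ N(A) with |B| = |A| - 1, so deficiency forces a positive weight.
  pairWeight : Positions n n t → Subset n → Subset n → ℕ
  pairWeight pos A B = 𝟙 (suc ∣ B ∣ ≟ ∣ A ∣) * rowsConfined A B pos

  deficiencyWeight : Positions n n t → ℕ
  deficiencyWeight {n} pos = ∑[ A ← allSubsets n ] ∑[ B ← allSubsets n ] pairWeight pos A B

  𝟙-deficient≤deficiencyWeight : ∀ (pos : Positions n n t) → 𝟙 (deficient? pos) ≤ deficiencyWeight pos
  𝟙-deficient≤deficiencyWeight pos with deficient? pos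
  ... | no  _                    = z≤n
  ... | yes (A , _ , ∣NA∣<∣A∣) with ∣ A ∣ in ∣A∣≡1+j | ∣NA∣<∣A∣
  ...   | suc j | s≤s ∣NA∣≤j with ∃-superset-of-size (neighbourhood (hits pos) A) j ∣NA∣≤j (<⇒≤ (subst (_≤ _) ∣A∣≡1+j (∣p∣≤n A)))
  ...     | B , NA⊆B , ∣B∣≡j = begin
    1                                   ≡⟨ pairWeight≡1 ⟨
    pairWeight pos A B                  ≤⟨ term≤∑ (pairWeight pos A) (∈-allSubsets B) ⟩
    ∑ (allSubsets _) (pairWeight pos A) ≤⟨ term≤∑ (λ A → ∑ (allSubsets _) (pairWeight pos A)) (∈-allSubsets A) ⟩
    deficiencyWeight pos                ∎
    where
    open ≤-Reasoning
    rows-in-B : ∀ {i} → i ∈ A → ∀ s → lookup (lookup pos i) s ∈ B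
    rows-in-B {i} i∈A s = NA⊆B (∈-neighbourhood⁺ (hits pos) i∈A (∈-rowSet⁺ (lookup pos i) s))
    pairWeight≡1 : pairWeight pos A B ≡ 1
    pairWeight≡1 = cong₂ _*_ (𝟙-yes (suc ∣ B ∣ ≟ ∣ A ∣) (trans (cong suc ∣B∣≡j) (sym ∣A∣≡1+j))) (rowsConfined≡1 A B pos rows-in-B)

  confinedCount : ℕ → ℕ → ℕ → ℕ → ℕ
  confinedCount n t a b = 𝟙 (suc b ≟ a) * ((b ^ t) ^ a * (n ^ t) ^ (n ∸ a))

  ∑-deficiencyWeight : ∀ n t → ∑[ pos ← allPositions n n t ] deficiencyWeight pos
                       ≡ ∑[ a ← upTo (suc n) ] (n C a) * (∑[ b ← upTo (suc n) ] (n C b) * confinedCount n t a b)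
  ∑-deficiencyWeight n t = begin
    ∑[ pos ← P ] ∑[ A ← S ] ∑[ B ← S ] pairWeight pos A B   ≡⟨ ∑-comm P S _ ⟩
    ∑[ A ← S ] ∑[ pos ← P ] ∑[ B ← S ] pairWeight pos A B   ≡⟨ ∑-cong S (λ A → ∑-comm P S _) ⟩
    ∑[ A ← S ] ∑[ B ← S ] ∑[ pos ← P ] pairWeight pos A B   ≡⟨ ∑-cong S (λ A → ∑-cong S (λ B → count A B)) ⟩
    ∑[ A ← S ] ∑[ B ← S ] confinedCount n t (∣ A ∣) (∣ B ∣) ≡⟨ ∑-cong S (λ A → ∑-by-size n (confinedCount n t ∣ A ∣)) ⟩
    ∑[ A ← S ] ∑[ b ← upTo (suc n) ] (n C b) * confinedCount n t ∣ A ∣ b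
        ≡⟨ ∑-by-size n (λ a → ∑[ b ← upTo (suc n) ] (n C b) * confinedCount n t a b) ⟩
    ∑[ a ← upTo (suc n) ] (n C a) * (∑[ b ← upTo (suc n) ] (n C b) * confinedCount n t a b) ∎
    where
    open ≡-Reasoning
    P : List (Positions n n t)
    P = allPositions n n t
    S : List (Subset n)
    S = allSubsets n
    count : ∀ A B → ∑[ pos ← P ] pairWeight pos A B ≡ confinedCount n t (∣ A ∣) (∣ B ∣)
    count A B = trans (*-distribˡ-∑ P (𝟙 (suc ∣ B ∣ ≟ ∣ A ∣)) (rowsConfined A B))
                      (cong (𝟙 (suc ∣ B ∣ ≟ ∣ A ∣) *_) (∑-rowsConfined n A B))

  size-term-bound : n ^ 10 ≤ 2 ^ t → ∀ a b → n ^ 3 * ((n C a) * ((n C b) * confinedCount n t a b)) ≤ (n ^ t) ^ n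
  size-term-bound {n} {t} n^10≤2^t a b with suc b ≟ a
  ... | no  a≢1+b = vanish (n ^ 3) (n C a) (n C b) (cong (_* ((b ^ t) ^ a * (n ^ t) ^ (n ∸ a))) (𝟙-no (suc b ≟ a) a≢1+b))
    where
    vanish : ∀ k x y {w} → w ≡ 0 → k * (x * (y * w)) ≤ (n ^ t) ^ n
    vanish k x y refl rewrite *-zeroʳ y | *-zeroʳ x | *-zeroʳ k = z≤n
  ... | yes refl with suc b ≤? n
  ...   | no 1+b≰n rewrite k>n⇒nCk≡0 (≰⇒> 1+b≰n) | *-zeroʳ (n ^ 3) = z≤n
  ...   | yes 1+b≤n with m≤n⇒∃[o]m+o≡n 1+b≤n
  ...     | c , refl = begin
    N ^ 3 * ((N C suc b) * ((N C b) * confinedCount N t (suc b) b)) ≡⟨ cong (λ w → N ^ 3 * ((N C suc b) * ((N C b) * w))) count ⟩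
    N ^ 3 * ((N C suc b) * ((N C b) * (X * Y)))                     ≡⟨ regroup (N ^ 3) (N C suc b) (N C b) X Y ⟩
    N ^ 3 * ((N C suc b) * (N C b)) * X * Y                         ≤⟨ *-monoˡ-≤ Y (pairs-bound b c t n^10≤2^t) ⟩
    (N ^ t) ^ suc b * Y                                             ≡⟨ ^-distribˡ-+-* (N ^ t) (suc b) c ⟨
    (N ^ t) ^ N                                                     ∎
    where
    open ≤-Reasoning
    N X Y : ℕ
    N = suc b + c
    X = (b ^ t) ^ suc b
    Y = (N ^ t) ^ c
    count : confinedCount N t (suc b) b ≡ X * Y
    count = trans (cong₂ _*_ (𝟙-yes (suc b ≟ suc b) refl) (cong (λ e → X * (N ^ t) ^ e) (m+n∸m≡n (suc b) c))) (*-identityˡ (X * Y))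
    regroup : ∀ k x y u v → k * (x * (y * (u * v))) ≡ k * (x * y) * u * v
    regroup = solve-∀

  4[1+n]²≤n³ : 6 ≤ n → 4 * (suc n * suc n) ≤ n ^ 3
  4[1+n]²≤n³ 6≤n with m≤n⇒∃[o]m+o≡n 6≤n
  ... | k , refl = ≤-trans (m≤m+n _ _) (≤-reflexive (expand k))
    where
    expand : ∀ k → 4 * (suc (6 + k) * suc (6 + k)) + (20 + 52 * k + 14 * (k * k) + k * k * k) ≡ (6 + k) * ((6 + k) * ((6 + k) * 1))
    expand = solve-∀

  n³*∑deficiencyWeight≤[1+n]²*P : n ^ 10 ≤ 2 ^ t →
    n ^ 3 * ∑ (allPositions n n t) deficiencyWeight ≤ suc n * (suc n * (n ^ t) ^ n)
  n³*∑deficiencyWeight≤[1+n]²*P {n} {t} n^10≤2^t = begin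
    n ^ 3 * ∑ (allPositions n n t) deficiencyWeight             ≡⟨ cong (n ^ 3 *_) (∑-deficiencyWeight n t) ⟩
    n ^ 3 * (∑[ a ← I ] (n C a) * (∑[ b ← I ] (n C b) * h a b)) ≡⟨ distribute ⟩
    ∑[ a ← I ] ∑[ b ← I ] n ^ 3 * ((n C a) * ((n C b) * h a b)) ≤⟨ ∑-mono I (λ a → ∑-mono I (size-term-bound {n} {t} n^10≤2^t a)) ⟩
    ∑[ a ← I ] ∑[ b ← I ] (n ^ t) ^ n                           ≡⟨ ∑-cong I (λ _ → ∑-const I _) ⟩
    ∑[ a ← I ] length I * (n ^ t) ^ n                           ≡⟨ ∑-const I _ ⟩
    length I * (length I * (n ^ t) ^ n)                         ≡⟨ cong (λ l → l * (l * (n ^ t) ^ n)) (length-upTo (suc n)) ⟩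
    suc n * (suc n * (n ^ t) ^ n)                               ∎
    where
    open ≤-Reasoning
    I : List ℕ
    I = upTo (suc n)
    h : ℕ → ℕ → ℕ
    h = confinedCount n t
    distribute : n ^ 3 * (∑[ a ← I ] (n C a) * (∑[ b ← I ] (n C b) * h a b)) ≡ ∑[ a ← I ] ∑[ b ← I ] n ^ 3 * ((n C a) * ((n C b) * h a b))
    distribute = sym (trans (∑-cong I (λ a → trans (*-distribˡ-∑ I (n ^ 3) _) (cong (n ^ 3 *_) (*-distribˡ-∑ I (n C a) _))))
                            (*-distribˡ-∑ I (n ^ 3) _))

  deficient-positions-bound : 6 ≤ n → n ^ 10 ≤ 2 ^ t →
    4 * (∑[ pos ← allPositions n n t ] 𝟙 (deficient? pos)) ≤ (n ^ t) ^ n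
  deficient-positions-bound {n@(suc _)} {t} 6≤n n^10≤2^t = *-cancelˡ-≤ (n ^ 3) (begin
    n ^ 3 * (4 * D)                     ≤⟨ *-monoʳ-≤ (n ^ 3) (*-monoʳ-≤ 4 (∑-mono P 𝟙-deficient≤deficiencyWeight)) ⟩
    n ^ 3 * (4 * W)                     ≡⟨ x∙yz≈y∙xz (n ^ 3) 4 W ⟩
    4 * (n ^ 3 * W)                     ≤⟨ *-monoʳ-≤ 4 (n³*∑deficiencyWeight≤[1+n]²*P {n} {t} n^10≤2^t) ⟩
    4 * (suc n * (suc n * (n ^ t) ^ n)) ≡⟨ trans (*-assoc 4 (suc n * suc n) ((n ^ t) ^ n)) (cong (4 *_) (*-assoc (suc n) (suc n) ((n ^ t) ^ n))) ⟨
    4 * (suc n * suc n) * (n ^ t) ^ n   ≤⟨ *-monoˡ-≤ ((n ^ t) ^ n) (4[1+n]²≤n³ 6≤n) ⟩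
    n ^ 3 * (n ^ t) ^ n                 ∎)
    where
    open ≤-Reasoning
    P : List (Positions n n t)
    P = allPositions n n t
    D W : ℕ
    D = ∑[ pos ← P ] 𝟙 (deficient? pos)
    W = ∑ P deficiencyWeight


module LeadingMinors where

  open import Level using (Level; _⊔_)
  open import Data.Nat as ℕ using (ℕ; zero; suc; z≤n)
  import Data.Nat.Properties as ℕ
  open import Data.Fin as Fin using (Fin; zero; suc; toℕ; punchIn; fromℕ<)
  import Data.Fin.Properties as Fin
  open import Data.Vec.Functional using (_∷_; removeAt)
  open import Data.Product using (_×_; _,_; proj₁; proj₂; ∃)
  open import Data.Sum using (_⊎_; inj₁; inj₂)
  open import Function using (_∘_)
  open import Relation.Binary.PropositionalEquality as ≡ using (_≡_; _≢_)
  open import Relation.Nullary using (¬_; Dec; yes; no; _×-dec_; _→-dec_)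
  open import Relation.Nullary.Decidable using (map′; decidable-stable; ¬?)
  open import Relation.Nullary.Negation using (contradiction)
  open import Relation.Unary using (Decidable)

  open import Defs

  crossing : ∀ {q} {Q : ℕ → Set q} → Decidable Q → Q 0 → ∀ m → ¬ Q m → ∃ λ k → k ℕ.< m × Q k × ¬ Q (suc k)
  crossing Q? q0 zero    ¬qm = contradiction q0 ¬qm
  crossing Q? q0 (suc m) ¬q1+m with Q? m
  ... | yes qm = m , ℕ.n<1+n m , qm , ¬q1+m
  ... | no ¬qm with crossing Q? q0 m ¬qm
  ...   | k , k<m , qk , ¬q1+k = k , ℕ.m<n⇒m<1+n k<m , qk , ¬q1+k

  module _ {c ℓ : Level} (F : FiniteField c ℓ) where

    open FiniteField F hiding (zero)
    open import Relation.Binary.Reasoning.Setoid setoid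
    open import Algebra.Properties.CommutativeMonoid.Sum +-commutativeMonoid using (sum; sum-cong-≋; sum-remove; ∑-distrib-+)
    open import Algebra.Properties.Semiring.Sum semiring using (*-distribˡ-sum)
    open import Algebra.Properties.Group +-group using (∙-cancelʳ; x∙y⁻¹≈ε⇒x≈y; inverseˡ-unique; ⁻¹-involutive)
    open import Algebra.Properties.Ring ring using (-‿distribˡ-*)

    private
      variable
        n : ℕ

    sumFin≡sum : ∀ (f : Fin n → Carrier) → sumFin F f ≡ sum f
    sumFin≡sum {zero}  f = ≡.refl
    sumFin≡sum {suc n} f = ≡.cong (f zero +_) (sumFin≡sum (f ∘ suc))

    index : Carrier → Fin order
    index x = proj₁ (enum-surjective x)

    _≈?_ : ∀ x y → Dec (x ≈ y)
    x ≈? y = map′ (λ eq → trans (sym (idx x)) (trans (reflexive (≡.cong enum eq)) (idx y)))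
                  (λ x≈y → enum-injective _ _ (trans (idx x) (trans x≈y (sym (idx y)))))
                  (index x Fin.≟ index y)
      where
      idx : ∀ x → enum (index x) ≈ x
      idx x = proj₂ (enum-surjective x)

    ∀-coefficients? : ∀ {p} n {P : (Fin n → Carrier) → Set p} →
                      (∀ {a b} → (∀ i → a i ≈ b i) → P a → P b) → (∀ a → Dec (P a)) → Dec (∀ a → P a)
    ∀-coefficients? zero    resp P? = map′ (λ p a → resp (λ ()) p) (λ ∀p → ∀p empty) (P? empty)
      where
      empty : Fin 0 → Carrier
      empty ()
    ∀-coefficients? (suc n) {P} resp P? =
      map′ (λ ∀p a → resp (head≈ a) (∀p (index (a zero)) (a ∘ suc))) (λ ∀p x g → ∀p (enum x ∷ g))
           (Fin.all? (λ x → ∀-coefficients? n (λ a≈b → resp (λ { zero → refl ; (suc i) → a≈b i })) (λ g → P? (enum x ∷ g))))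
      where
      head≈ : ∀ a i → (enum (index (a zero)) ∷ a ∘ suc) i ≈ a i
      head≈ a zero    = proj₂ (enum-surjective (a zero))
      head≈ a (suc i) = refl

    x≉0⇒x*y≈0⇒y≈0 : ∀ {x y} → ¬ x ≈ 0# → x * y ≈ 0# → y ≈ 0#
    x≉0⇒x*y≈0⇒y≈0 {x} {y} x≉0 xy≈0 with inverse x x≉0
    ... | x⁻¹ , x*x⁻¹≈1 = begin
      y             ≈⟨ *-identityˡ y ⟨
      1# * y        ≈⟨ *-congʳ x*x⁻¹≈1 ⟨
      (x * x⁻¹) * y ≈⟨ *-congʳ (*-comm x x⁻¹) ⟩
      (x⁻¹ * x) * y ≈⟨ *-assoc x⁻¹ x y ⟩
      x⁻¹ * (x * y) ≈⟨ *-congˡ xy≈0 ⟩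
      x⁻¹ * 0#      ≈⟨ zeroʳ x⁻¹ ⟩
      0#            ∎

    *-cancelˡ-≉0 : ∀ {x y z} → ¬ x ≈ 0# → x * y ≈ x * z → y ≈ z
    *-cancelˡ-≉0 {x} {y} {z} x≉0 xy≈xz = x∙y⁻¹≈ε⇒x≈y y z (x≉0⇒x*y≈0⇒y≈0 x≉0 (begin
      x * (y - z)     ≈⟨ distribˡ x y (- z) ⟩
      x * y + x * - z ≈⟨ +-congʳ xy≈xz ⟩
      x * z + x * - z ≈⟨ distribˡ x z (- z) ⟨
      x * (z - z)     ≈⟨ *-congˡ (-‿inverseʳ z) ⟩
      x * 0#          ≈⟨ zeroʳ x ⟩
      0#              ∎))

    x≉0∧y≉0⇒xy≉0 : ∀ {x y} → ¬ x ≈ 0# → ¬ y ≈ 0# → ¬ x * y ≈ 0#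
    x≉0∧y≉0⇒xy≉0 x≉0 y≉0 xy≈0 = y≉0 (x≉0⇒x*y≈0⇒y≈0 x≉0 xy≈0)

    ∑-linear : ∀ x y (f g : Fin n → Carrier) → sum (λ i → x * f i + y * g i) ≈ x * sum f + y * sum g
    ∑-linear x y f g = trans (∑-distrib-+ (λ i → x * f i) (λ i → y * g i))
                             (+-cong (sym (*-distribˡ-sum x f)) (sym (*-distribˡ-sum y g)))

    module _ (M : Fin n → Fin n → Carrier) (σ : Fin n → Fin n) where

      -- a is a linear relation among the first k rows of M restricted to the columns σ 0, …, σ (k-1)
      LeadingRelation : ℕ → (Fin n → Carrier) → Set ℓ
      LeadingRelation k a = (∀ i → k ℕ.≤ toℕ i → a i ≈ 0#) × (∀ l → toℕ l ℕ.< k → sum (λ i → a i * M i (σ l)) ≈ 0#)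

      LeadingIndependent : ℕ → Set (c ⊔ ℓ)
      LeadingIndependent k = ∀ a → LeadingRelation k a → ∀ i → a i ≈ 0#

      leadingRelation-resp : ∀ {k a b} → (∀ i → a i ≈ b i) → LeadingRelation k a → LeadingRelation k b
      leadingRelation-resp a≈b (a≥k≈0 , a-columns) =
        (λ i k≤i → trans (sym (a≈b i)) (a≥k≈0 i k≤i)) ,
        (λ l l<k → trans (sum-cong-≋ (λ i → *-congʳ (sym (a≈b i)))) (a-columns l l<k))

      leadingIndependent? : ∀ k → Dec (LeadingIndependent k)
      leadingIndependent? k = ∀-coefficients? n
        (λ a≈b a-trivial b-rel i → trans (sym (a≈b i)) (a-trivial (leadingRelation-resp (sym ∘ a≈b) b-rel) i))
        (λ a → leadingRelation? a →-dec Fin.all? (λ i → a i ≈? 0#))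
        where
        leadingRelation? : ∀ a → Dec (LeadingRelation k a)
        leadingRelation? a = Fin.all? (λ i → k ℕ.≤? toℕ i →-dec a i ≈? 0#)
                      ×-dec Fin.all? (λ l → toℕ l ℕ.<? k →-dec sum (λ i → a i * M i (σ l)) ≈? 0#)

      leadingIndependent-0 : LeadingIndependent 0
      leadingIndependent-0 a (a≈0 , _) i = a≈0 i z≤n

      leadingIndependent⇒rowsIndependent : LeadingIndependent n → RowsIndependent F M
      leadingIndependent⇒rowsIndependent indep a columns = indep a
        ((λ i n≤i → contradiction (Fin.toℕ<n i) (ℕ.≤⇒≯ n≤i)) ,
         (λ l _ → trans (reflexive (≡.sym (sumFin≡sum (λ i → a i * M i (σ l))))) (columns (σ l))))

      leadingIndependent-extend : ∀ {k : Fin n} → LeadingIndependent (toℕ k) →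
        ∀ {a} → LeadingRelation (suc (toℕ k)) a → a k ≈ 0# → ∀ i → a i ≈ 0#
      leadingIndependent-extend {k} indep {a} (a>k≈0 , a-columns) a[k]≈0 = indep a (a≥k≈0 , λ l l<k → a-columns l (ℕ.m<n⇒m<1+n l<k))
        where
        a≥k≈0 : ∀ i → toℕ k ℕ.≤ toℕ i → a i ≈ 0#
        a≥k≈0 i k≤i with ℕ.m≤n⇒m<n∨m≡n k≤i
        ... | inj₁ k<i = a>k≈0 i k<i
        ... | inj₂ k≡i rewrite Fin.toℕ-injective k≡i = a[k]≈0

    rowsIndependent? : (M : Fin n → Fin n → Carrier) → Dec (RowsIndependent F M)
    rowsIndependent? {n} M = ∀-coefficients? n resp
      (λ a → Fin.all? (λ j → sumFin F (λ i → a i * M i j) ≈? 0#) →-dec Fin.all? (λ i → a i ≈? 0#))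
      where
      Columns : (Fin n → Carrier) → Set ℓ
      Columns a = ∀ j → sumFin F (λ i → a i * M i j) ≈ 0#
      resp : ∀ {a b} → (∀ i → a i ≈ b i) → (Columns a → ∀ i → a i ≈ 0#) → Columns b → ∀ i → b i ≈ 0#
      resp {a} {b} a≈b a-trivial b-columns i = trans (sym (a≈b i)) (a-trivial a-columns i)
        where
        a-columns : Columns a
        a-columns j = begin
          sumFin F (λ i → a i * M i j) ≡⟨ sumFin≡sum (λ i → a i * M i j) ⟩
          sum (λ i → a i * M i j)      ≈⟨ sum-cong-≋ (λ i → *-congʳ (a≈b i)) ⟩
          sum (λ i → b i * M i j)      ≡⟨ sumFin≡sum (λ i → b i * M i j) ⟨
          sumFin F (λ i → b i * M i j) ≈⟨ b-columns j ⟩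
          0#                           ∎

    x+-y*z≈0⇒x≈y*z : ∀ {x y z} → x + (- y) * z ≈ 0# → x ≈ y * z
    x+-y*z≈0⇒x≈y*z {x} {y} {z} eq = begin
      x             ≈⟨ inverseˡ-unique x ((- y) * z) eq ⟩
      - ((- y) * z) ≈⟨ -‿cong (-‿distribˡ-* y z) ⟨
      - - (y * z)   ≈⟨ ⁻¹-involutive (y * z) ⟩
      y * z         ∎

    module EntryDetermined {n} {M M′ : Fin (suc n) → Fin (suc n) → Carrier} {σ : Fin (suc n) → Fin (suc n)}
      (σ-injective : ∀ {i j} → σ i ≡ σ j → i ≡ j) (k : Fin (suc n))
      (agree : ∀ i j → i ≢ k ⊎ j ≢ σ k → M i j ≈ M′ i j) where

      private
        K : ℕ
        K = toℕ k

      -- The combination b′ a - b a′ of the two relations vanishes at row k, hence is a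
      -- relation of the leading k-minor, hence zero.
      proportional : LeadingIndependent M σ K → ∀ {a a′} → LeadingRelation M σ (suc K) a → LeadingRelation M′ σ (suc K) a′ →
                     ∀ i → a′ k * a i ≈ a k * a′ i
      proportional indep {a} {a′} (a>k≈0 , a-columns) (a′>k≈0 , a′-columns) i =
        x+-y*z≈0⇒x≈y*z (indep comb (comb≥k≈0 , comb-columns) i)
        where
        b b′ : Carrier
        b = a k
        b′ = a′ k
        comb : Fin (suc n) → Carrier
        comb i = b′ * a i + (- b) * a′ i
        comb≥k≈0 : ∀ i → K ℕ.≤ toℕ i → comb i ≈ 0#
        comb≥k≈0 i k≤i with ℕ.m≤n⇒m<n∨m≡n k≤i
        ... | inj₁ k<i = begin
          b′ * a i + (- b) * a′ i ≈⟨ +-cong (*-congˡ (a>k≈0 i k<i)) (*-congˡ (a′>k≈0 i k<i)) ⟩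
          b′ * 0# + (- b) * 0#    ≈⟨ +-cong (zeroʳ b′) (zeroʳ (- b)) ⟩
          0# + 0#                 ≈⟨ +-identityˡ 0# ⟩
          0#                      ∎
        ... | inj₂ k≡i rewrite Fin.toℕ-injective (≡.sym k≡i) = begin
          b′ * b + (- b) * b′ ≈⟨ +-congˡ (-‿distribˡ-* b b′) ⟨
          b′ * b + - (b * b′) ≈⟨ +-congʳ (*-comm b′ b) ⟩
          b * b′ + - (b * b′) ≈⟨ -‿inverseʳ (b * b′) ⟩
          0#                  ∎
        comb-columns : ∀ l → toℕ l ℕ.< K → sum (λ i → comb i * M i (σ l)) ≈ 0#
        comb-columns l l<k = begin
          sum (λ i → comb i * M i (σ l))                                          ≈⟨ sum-cong-≋ (λ i → distribute (a i) (a′ i) (M i (σ l))) ⟩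
          sum (λ i → b′ * (a i * M i (σ l)) + (- b) * (a′ i * M i (σ l)))         ≈⟨ ∑-linear b′ (- b) (λ i → a i * M i (σ l)) (λ i → a′ i * M i (σ l)) ⟩
          b′ * sum (λ i → a i * M i (σ l)) + (- b) * sum (λ i → a′ i * M i (σ l)) ≈⟨ +-cong (*-congˡ (a-columns l (ℕ.m<n⇒m<1+n l<k))) (*-congˡ a′-column) ⟩
          b′ * 0# + (- b) * 0#                                                    ≈⟨ +-cong (zeroʳ b′) (zeroʳ (- b)) ⟩
          0# + 0#                                                                 ≈⟨ +-identityˡ 0# ⟩
          0#                                                                      ∎
          where
          distribute : ∀ x x′ m → (b′ * x + (- b) * x′) * m ≈ b′ * (x * m) + (- b) * (x′ * m)
          distribute x x′ m = trans (distribʳ m (b′ * x) ((- b) * x′)) (+-cong (*-assoc b′ x m) (*-assoc (- b) x′ m))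
          σl≢σk : σ l ≢ σ k
          σl≢σk σl≡σk = ℕ.<⇒≢ l<k (≡.cong toℕ (σ-injective σl≡σk))
          a′-column : sum (λ i → a′ i * M i (σ l)) ≈ 0#
          a′-column = trans (sum-cong-≋ {x = λ i → a′ i * M i (σ l)} (λ i → *-congˡ (agree i (σ l) (inj₂ σl≢σk)))) (a′-columns l (ℕ.m<n⇒m<1+n l<k))

      -- Column σ k of both relations, scaled by the other's k-th coefficient, agrees off row k.
      entry-agrees : LeadingIndependent M σ K → ∀ {a a′} → LeadingRelation M σ (suc K) a → LeadingRelation M′ σ (suc K) a′ →
                     ¬ a k ≈ 0# → ¬ a′ k ≈ 0# → M k (σ k) ≈ M′ k (σ k)
      entry-agrees indep {a} {a′} rel@(_ , a-columns) rel′@(_ , a′-columns) b≉0 b′≉0 =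
        *-cancelˡ-≉0 (x≉0∧y≉0⇒xy≉0 b′≉0 b≉0) (begin
          (b′ * b) * M k (σ k)  ≈⟨ *-assoc b′ b (M k (σ k)) ⟩
          b′ * f k              ≈⟨ ∙-cancelʳ rest (b′ * f k) (b * f′ k) (trans column (sym column′)) ⟩
          b * f′ k              ≈⟨ *-assoc b b′ (M′ k (σ k)) ⟨
          (b * b′) * M′ k (σ k) ≈⟨ *-congʳ (*-comm b b′) ⟩
          (b′ * b) * M′ k (σ k) ∎)
        where
        b b′ : Carrier
        b = a k
        b′ = a′ k
        k<1+k : K ℕ.< suc K
        k<1+k = ℕ.n<1+n K
        f f′ : Fin (suc n) → Carrier
        f i = a i * M i (σ k)
        f′ i = a′ i * M′ i (σ k)
        rest : Carrier
        rest = sum (removeAt (λ i → b′ * f i) k)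
        rest′≈rest : sum (removeAt (λ i → b * f′ i) k) ≈ rest
        rest′≈rest = sum-cong-≋ λ j → let i = punchIn k j ; i≢k = Fin.punchInᵢ≢i k j in begin
          b * (a′ i * M′ i (σ k)) ≈⟨ *-assoc b (a′ i) _ ⟨
          (b * a′ i) * M′ i (σ k) ≈⟨ *-cong (sym (proportional indep rel rel′ i)) (sym (agree i (σ k) (inj₁ i≢k))) ⟩
          (b′ * a i) * M i (σ k)  ≈⟨ *-assoc b′ (a i) _ ⟩
          b′ * (a i * M i (σ k))  ∎
        scaled-column : ∀ x g → sum g ≈ 0# → x * g k + sum (removeAt (λ i → x * g i) k) ≈ 0#
        scaled-column x g Σg≈0 = begin
          x * g k + sum (removeAt (λ i → x * g i) k) ≈⟨ sum-remove (λ i → x * g i) ⟨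
          sum (λ i → x * g i)                        ≈⟨ *-distribˡ-sum x g ⟨
          x * sum g                                  ≈⟨ *-congˡ Σg≈0 ⟩
          x * 0#                                     ≈⟨ zeroʳ x ⟩
          0#                                         ∎
        column : b′ * f k + rest ≈ 0#
        column = scaled-column b′ f (a-columns k k<1+k)
        column′ : b * f′ k + rest ≈ 0#
        column′ = trans (+-congˡ (sym rest′≈rest)) (scaled-column b f′ (a′-columns k k<1+k))

      entry-determined : LeadingIndependent M σ K → LeadingIndependent M′ σ K →
                         ¬ LeadingIndependent M σ (suc K) → ¬ LeadingIndependent M′ σ (suc K) → M k (σ k) ≈ M′ k (σ k)
      entry-determined indep indep′ dep dep′ = decidable-stable (M k (σ k) ≈? M′ k (σ k)) λ entries-differ →
        dep λ a rel → leadingIndependent-extend M σ indep rel (decidable-stable (a k ≈? 0#) λ b≉0 →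
          dep′ λ a′ rel′ → leadingIndependent-extend M′ σ indep′ rel′ (decidable-stable (a′ k ≈? 0#) λ b′≉0 →
            entries-differ (entry-agrees indep rel rel′ b≉0 b′≉0)))

    DependenceStartsAt : (M : Fin n → Fin n → Carrier) (σ : Fin n → Fin n) → Fin n → Set (c ⊔ ℓ)
    DependenceStartsAt M σ k = LeadingIndependent M σ (toℕ k) × ¬ LeadingIndependent M σ (suc (toℕ k))

    dependenceStartsAt? : (M : Fin n → Fin n → Carrier) (σ : Fin n → Fin n) → ∀ k → Dec (DependenceStartsAt M σ k)
    dependenceStartsAt? M σ k = leadingIndependent? M σ (toℕ k) ×-dec ¬? (leadingIndependent? M σ (suc (toℕ k)))

    dependent⇒∃-start : ∀ (M : Fin n → Fin n → Carrier) σ → ¬ RowsIndependent F M → ∃ (DependenceStartsAt M σ)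
    dependent⇒∃-start {n} M σ dependent
      with crossing (leadingIndependent? M σ) (leadingIndependent-0 M σ) n (dependent ∘ leadingIndependent⇒rowsIndependent M σ)
    ... | k , k<n , indep , dep = fromℕ< k<n , ≡.subst DependenceStartsAt′ (≡.sym (Fin.toℕ-fromℕ< k<n)) (indep , dep)
      where
      DependenceStartsAt′ : ℕ → Set (c ⊔ ℓ)
      DependenceStartsAt′ k = LeadingIndependent M σ k × ¬ LeadingIndependent M σ (suc k)


module SampledRows where

  open import Level using (Level)
  open import Data.Nat using (ℕ; suc)
  open import Data.Bool using (if_then_else_)
  open import Data.Fin as Fin using (Fin; zero; suc)
  open import Data.Vec using (Vec; []; _∷_; lookup; zipWith; updateAt)
  open import Data.Vec.Properties using (lookup-zipWith; lookup∘updateAt; lookup∘updateAt′)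
  open import Data.Product using (_×_; _,_)
  open import Data.Sum using (_⊎_; inj₁; inj₂; map₂)
  open import Function using (_∘_)
  open import Relation.Binary.PropositionalEquality as ≡ using (_≡_; _≢_)
  open import Relation.Nullary using (yes; no; does)
  open import Relation.Nullary.Negation using (contradiction)
  import Relation.Binary.Reasoning.Setoid

  open import Defs
  open DeficientPositions using (Positions)
  open LeadingMinors

  module _ {c ℓ : Level} (F : FiniteField c ℓ) where

    open FiniteField F hiding (zero)
    module ≈-Reasoning = Relation.Binary.Reasoning.Setoid setoid
    open import Algebra.Properties.CommutativeSemigroup +-commutativeSemigroup using (x∙yz≈y∙xz)
    open import Algebra.Properties.Group +-group using (∙-cancelʳ)

    private
      variable
        n t : ℕ

    Values : ℕ → ℕ → Set
    Values n t = Vec (Vec (Fin order) t) n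

    zipRow : Vec (Fin n) t → Vec (Fin order) t → RowSample F n t
    zipRow = zipWith _,_

    outcome : Positions n n t → Values n t → Outcome F n t
    outcome = zipWith zipRow

    contribution : Fin n × Fin order → Fin n → Carrier
    contribution (p , v) j = if does (p Fin.≟ j) then enum v else 0#

    rowWithout : RowSample F n t → Fin t → Fin n → Carrier
    rowWithout (_ ∷ xs)       zero    j = rowOf F xs j
    rowWithout ((p , v) ∷ xs) (suc s) j = contribution (p , v) j + rowWithout xs s j

    rowOf-split : ∀ (xs : RowSample F n t) s j → rowOf F xs j ≈ contribution (lookup xs s) j + rowWithout xs s j
    rowOf-split ((p , v) ∷ xs) zero    j with p Fin.≟ j
    ... | yes _ = refl
    ... | no  _ = sym (+-identityˡ (rowOf F xs j))
    rowOf-split ((p , v) ∷ xs) (suc s) j with p Fin.≟ j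
    ... | yes _ = trans (+-congˡ (rowOf-split xs s j)) (x∙yz≈y∙xz (enum v) _ _)
    ... | no  _ = trans (rowOf-split xs s j) (+-congˡ (sym (+-identityˡ _)))

    rowWithout-updateAt : ∀ (ps : Vec (Fin n) t) vs s f j → rowWithout (zipRow ps (updateAt vs s f)) s j ≡ rowWithout (zipRow ps vs) s j
    rowWithout-updateAt (p ∷ ps) (v ∷ vs) zero    f j = ≡.refl
    rowWithout-updateAt (p ∷ ps) (v ∷ vs) (suc s) f j = ≡.cong (contribution (p , v) j +_) (rowWithout-updateAt ps vs s f j)

    contribution-hit : ∀ p v → contribution {n} (p , v) p ≡ enum v
    contribution-hit p v with p Fin.≟ p
    ... | yes _   = ≡.refl
    ... | no  p≢p = contradiction ≡.refl p≢p

    contribution-miss : ∀ {p j} v → p ≢ j → contribution {n} (p , v) j ≡ 0#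
    contribution-miss {p = p} {j} v p≢j with p Fin.≟ j
    ... | yes p≡j = contradiction p≡j p≢j
    ... | no  _   = ≡.refl

    setValue : Values n t → Fin n → Fin t → Fin order → Values n t
    setValue vals k s y = updateAt vals k (λ r → updateAt r s (λ _ → y))

    module Resample (pos : Positions n n t) (vals : Values n t) (k : Fin n) (s : Fin t) where

      private
        p : Fin n
        p = lookup (lookup pos k) s
        rest : Fin n → Carrier
        rest = rowWithout (zipRow (lookup pos k) (lookup vals k)) s

      M : Fin order → Fin n → Fin n → Carrier
      M y = matrix F (outcome pos (setValue vals k s y))

      M-row : ∀ y i → M y i ≡ rowOf F (zipRow (lookup pos i) (lookup (setValue vals k s y) i))
      M-row y i = ≡.cong (rowOf F) (lookup-zipWith zipRow i pos (setValue vals k s y))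

      M-unchanged : ∀ y {i} → i ≢ k → M y i ≡ rowOf F (zipRow (lookup pos i) (lookup vals i))
      M-unchanged y {i} i≢k = ≡.trans (M-row y i) (≡.cong (rowOf F ∘ zipRow (lookup pos i)) (lookup∘updateAt′ i k i≢k vals))

      M-other-row : ∀ y y′ {i} j → i ≢ k → M y i j ≡ M y′ i j
      M-other-row y y′ j i≢k = ≡.cong (λ r → r j) (≡.trans (M-unchanged y i≢k) (≡.sym (M-unchanged y′ i≢k)))

      M-row-k : ∀ y j → M y k j ≈ contribution (p , y) j + rest j
      M-row-k y j = begin
        M y k j                                        ≡⟨ ≡.cong (λ r → r j) (M-row y k) ⟩
        rowOf F (zipRow (lookup pos k) (lookup (setValue vals k s y) k)) j
                                                       ≡⟨ ≡.cong (λ v → rowOf F (zipRow (lookup pos k) v) j) (lookup∘updateAt k vals) ⟩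
        rowOf F (zipRow (lookup pos k) vs) j           ≈⟨ rowOf-split (zipRow (lookup pos k) vs) s j ⟩
        contribution (lookup (zipRow (lookup pos k) vs) s) j + rowWithout (zipRow (lookup pos k) vs) s j
          ≡⟨ ≡.cong₂ (λ x r → contribution x j + r) sample-s (rowWithout-updateAt (lookup pos k) (lookup vals k) s (λ _ → y) j) ⟩
        contribution (p , y) j + rest j                ∎
        where
        open ≈-Reasoning
        vs : Vec (Fin order) t
        vs = updateAt (lookup vals k) s (λ _ → y)
        sample-s : lookup (zipRow (lookup pos k) vs) s ≡ (p , y)
        sample-s = ≡.trans (lookup-zipWith _,_ s (lookup pos k) vs) (≡.cong (p ,_) (lookup∘updateAt s (lookup vals k)))

      M-entry : ∀ y → M y k p ≈ enum y + rest p
      M-entry y = trans (M-row-k y p) (+-congʳ (reflexive (contribution-hit p y)))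

      M-agree : ∀ y y′ i j → i ≢ k ⊎ j ≢ p → M y i j ≈ M y′ i j
      M-agree y y′ i j (inj₁ i≢k) = reflexive (M-other-row y y′ j i≢k)
      M-agree y y′ i j (inj₂ j≢p) with i Fin.≟ k
      ... | no  i≢k    = reflexive (M-other-row y y′ j i≢k)
      ... | yes ≡.refl = begin
        M y k j                          ≈⟨ M-row-k y j ⟩
        contribution (p , y) j + rest j  ≡⟨ ≡.cong (_+ rest j) (≡.trans (contribution-miss y p≢j) (≡.sym (contribution-miss y′ p≢j))) ⟩
        contribution (p , y′) j + rest j ≈⟨ M-row-k y′ j ⟨
        M y′ k j                         ∎
        where
        open ≈-Reasoning
        p≢j : p ≢ j
        p≢j = j≢p ∘ ≡.sym

    start-value-unique : ∀ {n} (pos : Positions (suc n) (suc n) t) {σ : Fin (suc n) → Fin (suc n)} →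
      (∀ {i j} → σ i ≡ σ j → i ≡ j) → ∀ vals k {s} → lookup (lookup pos k) s ≡ σ k → ∀ y y′ →
      DependenceStartsAt F (matrix F (outcome pos (setValue vals k s y))) σ k →
      DependenceStartsAt F (matrix F (outcome pos (setValue vals k s y′))) σ k → y ≡ y′
    start-value-unique {n} pos {σ} σ-injective vals k {s} hit y y′ (indep , dep) (indep′ , dep′) = enum-injective y y′
      (∙-cancelʳ _ (enum y) (enum y′) (begin
        enum y + rest (σ k)  ≈⟨ entry y ⟨
        R.M y k (σ k)        ≈⟨ Entry.entry-determined indep indep′ dep dep′ ⟩
        R.M y′ k (σ k)       ≈⟨ entry y′ ⟩
        enum y′ + rest (σ k) ∎))
      where
      open ≈-Reasoning
      module R = Resample pos vals k s
      rest : Fin _ → Carrier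
      rest = rowWithout (zipRow (lookup pos k) (lookup vals k)) s
      entry : ∀ y → R.M y k (σ k) ≈ enum y + rest (σ k)
      entry y = ≡.subst (λ j → R.M y k j ≈ enum y + rest j) hit (R.M-entry y)
      module Entry = EntryDetermined F σ-injective k
        (λ i j i≢k⊎j≢σk → R.M-agree y y′ i j (map₂ (λ j≢σk j≡p → j≢σk (≡.trans j≡p hit)) i≢k⊎j≢σk))


module Outcomes where

  open import Level using (Level)
  open import Data.Nat
  open import Data.Nat.Properties
  open import Data.Nat.Tactic.RingSolver using (solve-∀)
  open import Data.Fin using (Fin; zero; suc)
  open import Data.Fin.Subset using (⊤) renaming (_∈_ to _∈ₛ_)
  open import Data.Fin.Subset.Properties using (∈⊤)
  open import Data.List using (List; length; allFin; filter; cartesianProductWith)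
  open import Data.List.Membership.Propositional.Properties using (∈-allFin)
  open import Data.List.Relation.Unary.All using (All)
  open import Data.List.Relation.Unary.All.Properties using (all-filter)
  open import Data.List.Relation.Unary.Unique.Propositional using (Unique)
  import Data.List.Relation.Unary.Unique.Propositional.Properties as Unique
  open import Data.Vec using (Vec; []; _∷_; lookup; zipWith; updateAt)
  open import Data.Vec.Properties using (∷-injective)
  open import Data.Product using (_×_; _,_; proj₁; proj₂; ∃)
  open import Data.Sum using (inj₁; inj₂)
  open import Function using (_∘_)
  open import Relation.Binary.PropositionalEquality
  open import Relation.Nullary using (¬_; Dec; yes; no)
  open import Relation.Nullary.Decidable using (¬?)
  open import Relation.Nullary.Negation using (contradiction)

  open import Defs
  open Arithmetic using (^-distribʳ-*)
  open FiniteSums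
  open Hall
  open DeficientPositions
  open LeadingMinors
  open SampledRows

  zipWith-injective : ∀ {a b c} {A : Set a} {B : Set b} {C : Set c} {m} (f : A → B → C) →
    (∀ {w x y z} → f w y ≡ f x z → w ≡ x × y ≡ z) →
    ∀ {xs xs′ : Vec A m} {ys ys′ : Vec B m} → zipWith f xs ys ≡ zipWith f xs′ ys′ → xs ≡ xs′ × ys ≡ ys′
  zipWith-injective f f-inj {[]}     {[]}       {[]}     {[]}       refl = refl , refl
  zipWith-injective f f-inj {x ∷ xs} {x′ ∷ xs′} {y ∷ ys} {y′ ∷ ys′} eq
    with f-inj (proj₁ (∷-injective eq)) | zipWith-injective f f-inj (proj₂ (∷-injective eq))
  ... | refl , refl | refl , refl = refl , refl

  module _ {c ℓ : Level} (F : FiniteField c ℓ) where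

    open FiniteField F using (Carrier; order)

    private
      variable
        n t : ℕ

    allValues : ∀ n t → List (Values F n t)
    allValues n t = allVecs (allVecs (allFin order) t) n

    length-allValues : ∀ n t → length (allValues n t) ≡ (order ^ t) ^ n
    length-allValues n t = trans (length-allVecs (allVecs (allFin order) t) n) (cong (_^ n) (length-allVecs-allFin order t))

    allOutcomes : ∀ n t → List (Outcome F n t)
    allOutcomes n t = cartesianProductWith (outcome F) (allPositions n n t) (allValues n t)

    allOutcomes⁺ : Unique (allOutcomes n t)
    allOutcomes⁺ {n} {t} = Unique.cartesianProductWith⁺ (outcome F)
      (zipWith-injective (zipRow F) (zipWith-injective _,_ λ { refl → refl , refl }))
      (allVecs⁺ (allVecs⁺ (Unique.allFin⁺ n) t) n) (allVecs⁺ (allVecs⁺ (Unique.allFin⁺ order) t) n)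

    length-allOutcomes : ∀ n t → length (allOutcomes n t) ≡ (n ^ t) ^ n * (order ^ t) ^ n
    length-allOutcomes n t = trans (length-cartesianProductWith (outcome F) (allPositions n n t) (allValues n t))
      (cong₂ _*_ (length-allPositions n n t) (length-allValues n t))

    module Matched {n} (pos : Positions (suc n) (suc n) t) (σ : Fin (suc n) → Fin (suc n))
      (σ∈hits : ∀ i → σ i ∈ₛ hits pos i) (σ-injective : ∀ {i j} → σ i ≡ σ j → i ≡ j) where

      private
        V : ℕ
        V = (order ^ t) ^ suc n

      M : Values F (suc n) t → Fin (suc n) → Fin (suc n) → Carrier
      M vals = matrix F (outcome F pos vals)

      hitting : Fin (suc n) → Fin t
      hitting k = proj₁ (∈-rowSet⁻ (lookup pos k) (σ∈hits k))

      hitting-σ : ∀ k → lookup (lookup pos k) (hitting k) ≡ σ k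
      hitting-σ k = proj₂ (∈-rowSet⁻ (lookup pos k) (σ∈hits k))

      order*#starts≤V : ∀ k → order * (∑[ vals ← allValues (suc n) t ] 𝟙 (dependenceStartsAt? F (M vals) σ k)) ≤ V
      order*#starts≤V k = begin
        order * ∑ Vs starts                                                           ≡⟨ cong (_* ∑ Vs starts) (length-allFin order) ⟨
        length (allFin order) * ∑ Vs starts                                           ≡⟨ resampling k (hitting k) starts ⟩
        ∑[ vals ← Vs ] ∑[ y ← allFin order ] starts (setValue F vals k (hitting k) y) ≤⟨ ∑-mono Vs at-most-one ⟩
        ∑[ vals ← Vs ] 1                                                              ≡⟨ ∑-const Vs 1 ⟩
        length Vs * 1                                                                 ≡⟨ *-identityʳ (length Vs) ⟩
        length Vs                                                                     ≡⟨ length-allValues (suc n) t ⟩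
        V                                                                             ∎
        where
        open ≤-Reasoning
        Vs : List (Values F (suc n) t)
        Vs = allValues (suc n) t
        starts : Values F (suc n) t → ℕ
        starts vals = 𝟙 (dependenceStartsAt? F (M vals) σ k)
        resampling : ∀ k s → Resampling Vs (allFin order) (λ vals y → setValue F vals k s y)
        resampling k s = resampling-updateAt {xs = allVecs (allFin order) t} {ys = allFin order} {u = λ r y → updateAt r s (λ _ → y)}
          (resampling-updateAt {xs = allFin order} {ys = allFin order} {u = λ _ y → y} (resampling-replace (allFin order)) t s) (suc n) k
        at-most-one : ∀ vals → ∑[ y ← allFin order ] starts (setValue F vals k (hitting k) y) ≤ 1
        at-most-one vals = ∑𝟙≤1 (λ y → dependenceStartsAt? F (M (setValue F vals k (hitting k) y)) σ k)
                                (allFin order) (Unique.allFin⁺ order) (start-value-unique F pos σ-injective vals k (hitting-σ k))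

      𝟙-dependent≤∑starts : ∀ vals → 𝟙 (¬? (rowsIndependent? F (M vals))) ≤ ∑[ k ← allFin (suc n) ] 𝟙 (dependenceStartsAt? F (M vals) σ k)
      𝟙-dependent≤∑starts vals = bound (rowsIndependent? F (M vals))
        where
        bound : (independent? : Dec (RowsIndependent F (M vals))) →
                𝟙 (¬? independent?) ≤ ∑[ k ← allFin (suc n) ] 𝟙 (dependenceStartsAt? F (M vals) σ k)
        bound (yes _)         = z≤n
        bound (no  dependent) with dependent⇒∃-start F (M vals) σ dependent
        ... | k , start = ≤-trans (≤-reflexive (sym (𝟙-yes (dependenceStartsAt? F (M vals) σ k) start)))
                                  (term≤∑ (λ k → 𝟙 (dependenceStartsAt? F (M vals) σ k)) (∈-allFin k))

      2*#dependent≤V : 2 * suc n ≤ order → 2 * (∑[ vals ← allValues (suc n) t ] 𝟙 (¬? (rowsIndependent? F (M vals)))) ≤ V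
      2*#dependent≤V 2n≤order = *-cancelˡ-≤ (suc n) (begin
        suc n * (2 * B)                                    ≡⟨ *-assoc (suc n) 2 B ⟨
        suc n * 2 * B                                      ≡⟨ cong (_* B) (*-comm (suc n) 2) ⟩
        2 * suc n * B                                      ≤⟨ *-monoˡ-≤ B 2n≤order ⟩
        order * B                                          ≤⟨ *-monoʳ-≤ order (∑-mono Vs 𝟙-dependent≤∑starts) ⟩
        order * (∑[ vals ← Vs ] ∑[ k ← Ks ] starts k vals) ≡⟨ cong (order *_) (∑-comm Vs Ks (λ vals k → starts k vals)) ⟩
        order * (∑[ k ← Ks ] ∑[ vals ← Vs ] starts k vals) ≡⟨ *-distribˡ-∑ Ks order (λ k → ∑ Vs (starts k)) ⟨
        ∑[ k ← Ks ] order * ∑ Vs (starts k)                ≤⟨ ∑-mono Ks order*#starts≤V ⟩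
        ∑[ k ← Ks ] V                                      ≡⟨ ∑-const Ks V ⟩
        length Ks * V                                      ≡⟨ cong (_* V) (length-allFin (suc n)) ⟩
        suc n * V                                          ∎)
        where
        open ≤-Reasoning
        Vs : List (Values F (suc n) t)
        Vs = allValues (suc n) t
        Ks : List (Fin (suc n))
        Ks = allFin (suc n)
        B : ℕ
        B = ∑[ vals ← Vs ] 𝟙 (¬? (rowsIndependent? F (M vals)))
        starts : Fin (suc n) → Values F (suc n) t → ℕ
        starts k vals = 𝟙 (dependenceStartsAt? F (M vals) σ k)

    dependent? : (ω : Outcome F n t) → Dec (¬ GoodOutcome F ω)
    dependent? ω = ¬? (rowsIndependent? F (matrix F ω))

    #dependent≤V : ∀ (pos : Positions n n t) → ∑[ vals ← allValues n t ] 𝟙 (dependent? (outcome F pos vals)) ≤ (order ^ t) ^ n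
    #dependent≤V {n} {t} pos = begin
      ∑[ vals ← Vs ] 𝟙 (dependent? (outcome F pos vals)) ≤⟨ ∑-mono Vs (λ vals → 𝟙≤1 (dependent? (outcome F pos vals))) ⟩
      ∑[ vals ← Vs ] 1                                   ≡⟨ ∑-const Vs 1 ⟩
      length Vs * 1                                      ≡⟨ *-identityʳ (length Vs) ⟩
      length Vs                                          ≡⟨ length-allValues n t ⟩
      (order ^ t) ^ n                                    ∎
      where
      open ≤-Reasoning
      Vs : List (Values F n t)
      Vs = allValues n t

    2*#dependent≤V+2V𝟙deficient : ∀ {n} → 2 * suc n ≤ order → ∀ (pos : Positions (suc n) (suc n) t) →
      2 * (∑[ vals ← allValues (suc n) t ] 𝟙 (dependent? (outcome F pos vals)))
        ≤ (order ^ t) ^ suc n + 2 * ((order ^ t) ^ suc n * 𝟙 (deficient? pos))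
    2*#dependent≤V+2V𝟙deficient {t} {n} 2n≤order pos = bound (deficient? pos)
      where
      open ≤-Reasoning
      V B : ℕ
      V = (order ^ t) ^ suc n
      B = ∑[ vals ← allValues (suc n) t ] 𝟙 (dependent? (outcome F pos vals))
      bound : (deficient? : Dec (Deficient (hits pos) ⊤)) → 2 * B ≤ V + 2 * (V * 𝟙 deficient?)
      bound (yes _) = begin
        2 * B           ≤⟨ *-monoʳ-≤ 2 (#dependent≤V pos) ⟩
        V + (V + 0)     ≡⟨ cong (V +_) (+-identityʳ V) ⟩
        V + V           ≤⟨ +-monoʳ-≤ V (≤-trans (≤-reflexive (sym (*-identityʳ V))) (m≤m+n (V * 1) _)) ⟩
        V + 2 * (V * 1) ∎
      bound (no ¬deficient) with hall zero (hits pos) ⊤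
      ... | inj₂ deficient = contradiction deficient ¬deficient
      ... | inj₁ (σ , σ∈hits , σ-injective) =
        ≤-trans (Matched.2*#dependent≤V pos σ (λ i → σ∈hits ∈⊤) (σ-injective ∈⊤ ∈⊤) 2n≤order) (m≤m+n _ _)

    4*#dependent≤3PV : ∀ {n} → 6 ≤ suc n → suc n ^ 10 ≤ 2 ^ t → 2 * suc n ≤ order →
      4 * (∑[ ω ← allOutcomes (suc n) t ] 𝟙 (dependent? ω)) ≤ 3 * ((suc n ^ t) ^ suc n * (order ^ t) ^ suc n)
    4*#dependent≤3PV {t} {n} 6≤n n^10≤2^t 2n≤order = begin
      4 * B                     ≡⟨ *-assoc 2 2 B ⟩
      2 * (2 * B)               ≤⟨ *-monoʳ-≤ 2 2B≤PV+2VD ⟩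
      2 * (P * V + 2 * (V * D)) ≡⟨ rearrange (P * V) V D ⟩
      2 * (P * V) + V * (4 * D) ≤⟨ +-monoʳ-≤ (2 * (P * V)) (*-monoʳ-≤ V (deficient-positions-bound {suc n} {t} 6≤n n^10≤2^t)) ⟩
      2 * (P * V) + V * P       ≡⟨ cong (2 * (P * V) +_) (*-comm V P) ⟩
      2 * (P * V) + P * V       ≡⟨ +-comm (2 * (P * V)) (P * V) ⟩
      3 * (P * V)               ∎
      where
      open ≤-Reasoning
      Ps : List (Positions (suc n) (suc n) t)
      Ps = allPositions (suc n) (suc n) t
      Vs : List (Values F (suc n) t)
      Vs = allValues (suc n) t
      P V B D : ℕ
      P = (suc n ^ t) ^ suc n
      V = (order ^ t) ^ suc n
      B = ∑[ ω ← allOutcomes (suc n) t ] 𝟙 (dependent? ω)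
      D = ∑[ pos ← Ps ] 𝟙 (deficient? pos)
      rearrange : ∀ x v d → 2 * (x + 2 * (v * d)) ≡ 2 * x + v * (4 * d)
      rearrange = solve-∀
      2B≤PV+2VD : 2 * B ≤ P * V + 2 * (V * D)
      2B≤PV+2VD = begin
        2 * B                                                                  ≡⟨ cong (2 *_) (∑-cartesianProductWith (outcome F) Ps Vs (𝟙 ∘ dependent?)) ⟩
        2 * (∑[ pos ← Ps ] ∑[ vals ← Vs ] 𝟙 (dependent? (outcome F pos vals))) ≡⟨ *-distribˡ-∑ Ps 2 _ ⟨
        ∑[ pos ← Ps ] 2 * (∑[ vals ← Vs ] 𝟙 (dependent? (outcome F pos vals))) ≤⟨ ∑-mono Ps (2*#dependent≤V+2V𝟙deficient {t} 2n≤order) ⟩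
        ∑[ pos ← Ps ] (V + 2 * (V * 𝟙 (deficient? pos)))                       ≡⟨ ∑-distrib-+ Ps (λ _ → V) _ ⟩
        ∑ Ps (λ _ → V) + (∑[ pos ← Ps ] 2 * (V * 𝟙 (deficient? pos)))          ≡⟨ cong₂ _+_ (∑-const Ps V) (trans (*-distribˡ-∑ Ps 2 _) (cong (2 *_) (*-distribˡ-∑ Ps V _))) ⟩
        length Ps * V + 2 * (V * D)                                            ≡⟨ cong (λ l → l * V + 2 * (V * D)) (length-allPositions (suc n) (suc n) t) ⟩
        P * V + 2 * (V * D)                                                    ∎

    good-outcomes : ∀ {n} → 6 ≤ n → n ^ 10 ≤ 2 ^ t → 2 * n ≤ order →
      ∃ λ (L : List (Outcome F n t)) → Unique L × All (GoodOutcome F) L × ((n ^ t) * (order ^ t)) ^ n ≤ 4 * length L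
    good-outcomes {t} {n@(suc _)} 6≤n n^10≤2^t 2n≤order =
      L , Unique.filter⁺ good? allOutcomes⁺ , all-filter good? (allOutcomes n t) , (begin
        ((n ^ t) * (order ^ t)) ^ n   ≡⟨ ^-distribʳ-* (n ^ t) (order ^ t) n ⟩
        (n ^ t) ^ n * (order ^ t) ^ n ≡⟨ length-allOutcomes n t ⟨
        length Ω                      ≤⟨ +-cancelʳ-≤ (3 * length Ω) (length Ω) (4 * G) 4|Ω|≤4G+3|Ω| ⟩
        4 * G                         ≡⟨ cong (4 *_) (length-filter≡∑𝟙 good? Ω) ⟨
        4 * length L                  ∎)
      where
      open ≤-Reasoning
      good? : ∀ ω → Dec (GoodOutcome F ω)
      good? ω = rowsIndependent? F (matrix F ω)
      Ω L : List (Outcome F n t)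
      Ω = allOutcomes n t
      L = filter good? Ω
      G B : ℕ
      G = ∑[ ω ← Ω ] 𝟙 (good? ω)
      B = ∑[ ω ← Ω ] 𝟙 (dependent? ω)
      G+B≡|Ω| : G + B ≡ length Ω
      G+B≡|Ω| = trans (sym (∑-distrib-+ Ω (𝟙 ∘ good?) (𝟙 ∘ dependent?)))
                      (trans (∑-cong Ω (𝟙+𝟙¬≡1 ∘ good?)) (trans (∑-const Ω 1) (*-identityʳ (length Ω))))
      4|Ω|≤4G+3|Ω| : length Ω + 3 * length Ω ≤ 4 * G + 3 * length Ω
      4|Ω|≤4G+3|Ω| = begin
        4 * length Ω         ≡⟨ cong (4 *_) G+B≡|Ω| ⟨
        4 * (G + B)          ≡⟨ *-distribˡ-+ 4 G B ⟩
        4 * G + 4 * B        ≤⟨ +-monoʳ-≤ (4 * G) (≤-trans (4*#dependent≤3PV {t} 6≤n n^10≤2^t 2n≤order) (≤-reflexive (cong (3 *_) (sym (length-allOutcomes n t))))) ⟩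
        4 * G + 3 * length Ω ∎


open import Defs
open import Level using (0ℓ)
open import Data.Nat using (ℕ; suc; _*_; _^_; _≤_)
open import Data.Product using (_×_; ∃-syntax; _,_)
open import Data.List using (List; length)
open import Data.List.Relation.Unary.All using (All)
open import Data.List.Relation.Unary.Unique.Propositional using (Unique)
open Arithmetic using (n≤2^⌈log₂n⌉)
open Outcomes using (good-outcomes)

lemma3p3 : ∃[ k ] ∃[ n₀ ] ∀ (n : ℕ) → n₀ ≤ n →
    (F : FiniteField 0ℓ 0ℓ) → 2 * n ≤ FiniteField.order F →
    ∃[ L ] (Unique {A = Outcome F n (samples n)} L
           × All (GoodOutcome F) L
           × ((n ^ samples n) * (FiniteField.order F ^ samples n)) ^ n ≤ suc k * length L)
lemma3p3 = 3 , 6 , λ n 6≤n F 2n≤q → good-outcomes F 6≤n (n≤2^⌈log₂n⌉ (n ^ 10)) 2n≤q
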